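{- Start the deterministic scan bounding chain at $y_0=((*,*,\dots,*,1),1)$ and run it for $t$ sweeps with iid fair coins, where $t$ is an integer with $t\ge (n^2-n+3)\lceil\log_2(n)\rceil/2$. Then the probability that any $*$ symbol remains in the resulting bounding state is at most $1/2$.
   Context: Let $n\ge 2$, $\preceq$ a partial order on $[n]$ with the identity permutation a linear extension (i.e. $a\preceq b$ implies $a\le b$). A bounding state is $(r,k)$ with $k\in[n]$, $r\in(\{*\}\cup[n])^n$ with distinct numeric entries at most $k$. The bounding step $B((r,k),i,c)$ for $i\in\{1,\dots,n-1\}$, $c\in\{0,1\}$: if $c=1$ and it is not the case that $r(i),r(i+1)\in[n]$ with $r(i)\preceq r(i+1)$, exchange the entries in positions $i,i+1$; then if $r(n)=*$ set $r(n)\leftarrow k+1$, $k\leftarrow k+1$. A sweep draws fresh iid fair bits $c_1,\dots,c_{n-1}$ and applies $B(\cdot,i,c_i)$ for $i=1,\dots,n-1$ in order. -}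

module Defs where

open import Data.Nat using (ℕ; zero; suc; _+_; _*_; _∸_; _^_; _≤_; _<_; _<?_)
open import Data.Bool using (Bool; true; false; if_then_else_; _∧_; not)
open import Data.Maybe using (Maybe; just; nothing; is-nothing)
open import Data.Bool.ListAction using (any)
open import Data.List using (List; []; _∷_; _++_; replicate; length; filterᵇ; concatMap; map)
open import Data.Vec using (Vec; []; _∷_)
open import Data.Fin using (Fin; fromℕ<)
open import Data.Product using (_×_; _,_; proj₁)
open import Relation.Binary.Core using (Rel)
open import Level using (0ℓ)
open import Relation.Binary.Definitions using (Decidable)
open import Relation.Nullary using (yes; no; does)

-- An element a : Fin n stands for the element (toℕ a + 1) of [n] = {1,…,n}.
-- Numeric entries of a bounding state are natural numbers in 1..n.
toFin : (n : ℕ) → ℕ → Maybe (Fin n)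
toFin n zero = nothing
toFin n (suc a) with a <? n
... | yes a<n = just (fromℕ< a<n)
... | no _ = nothing

-- Entries: nothing = the symbol *, just v = the number v.
Entry : Set
Entry = Maybe ℕ

State : Set
State = List Entry × ℕ

module Chain (n : ℕ) (_⪯_ : Rel (Fin n) 0ℓ) (_⪯?_ : Decidable _⪯_) where

  comparable : Entry → Entry → Bool
  comparable (just a) (just b) with toFin n a | toFin n b
  ... | just x | just y = does (x ⪯? y)
  ... | _ | _ = false
  comparable _ _ = false

  condSwap : ℕ → Bool → List Entry → List Entry
  condSwap (suc zero) c (x ∷ y ∷ xs) =
    if c ∧ not (comparable x y) then y ∷ x ∷ xs else x ∷ y ∷ xs
  condSwap (suc (suc i)) c (x ∷ xs) = x ∷ condSwap (suc i) c xs
  condSwap _ _ xs = xs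

  fillLast : List Entry → ℕ → List Entry × ℕ
  fillLast [] k = [] , k
  fillLast (nothing ∷ []) k = just (suc k) ∷ [] , suc k
  fillLast (just v ∷ []) k = just v ∷ [] , k
  fillLast (x ∷ y ∷ xs) k with fillLast (y ∷ xs) k
  ... | r' , k' = x ∷ r' , k'

  B : State → ℕ → Bool → State
  B (r , k) i c = fillLast (condSwap i c r) k

  sweepFrom : ℕ → {m : ℕ} → Vec Bool m → State → State
  sweepFrom i [] s = s
  sweepFrom i (c ∷ cs) s = sweepFrom (suc i) cs (B s i c)

  sweep : Vec Bool (n ∸ 1) → State → State
  sweep cs s = sweepFrom 1 cs s

  run : {t : ℕ} → Vec (Vec Bool (n ∸ 1)) t → State → State
  run [] s = s
  run (cs ∷ css) s = run css (sweep cs s)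

  y₀ : State
  y₀ = replicate (n ∸ 1) nothing ++ just 1 ∷ [] , 1

  hasStar : State → Bool
  hasStar (r , k) = any is-nothing r

allVecs : {A : Set} → List A → (m : ℕ) → List (Vec A m)
allVecs xs zero = [] ∷ []
allVecs xs (suc m) = concatMap (λ x → map (x ∷_) (allVecs xs m)) xs

-- all possible outcomes of t sweeps of fair coins (uniformly distributed)
allCoinSeqs : (n t : ℕ) → List (Vec (Vec Bool (n ∸ 1)) t)
allCoinSeqs n t = allVecs (allVecs (true ∷ false ∷ []) (n ∸ 1)) t

badCount : (n : ℕ) (_⪯_ : Rel (Fin n) 0ℓ) (_⪯?_ : Decidable _⪯_) (t : ℕ) → ℕ
badCount n _⪯_ _⪯?_ t =
  length (filterᵇ (λ css → hasStar (run css y₀)) (allCoinSeqs n t))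
  where open Chain n _⪯_ _⪯?_

-- On the positions holding *, the bounding chain does not depend on ⪯: a swap can only be
-- blocked between two numbers.  So each coin 1 transposes the star pattern at positions i, i+1,
-- and a star reaching position n is replaced by a number.  These pattern operations commute with pointwise ∨, hence (union bound) the bad coin
-- sequences are at most the sequences after which the star started at p survives, summed over p.
--
-- A single star moves on 1 … n-1 (0 once replaced).  The potential
-- h p = 1 + (p-1) + p + … + (n-1) drops by exactly 1 in expectation per sweep while the star is
-- alive, and h ≤ H = 1 + n(n-1)/2.  So E[h] shrinks by the factor 1 - 1/H per sweep, and as h is
-- the expected remaining lifetime, s further sweeps leave survival probability at most E[h]/s.  With
-- a = H (⌈log₂ n⌉ - 1), s ≥ H, (1 - 1/H)^H ≤ 3/8 and Σ_p h p = (n³ - n)/3 the union bound is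
-- at most 1/2 for n ≥ 17; for smaller n the exact survival counts are evaluated from a closed
-- form of one sweep.  Probabilities are kept as counts of coin outcomes throughout.

module Submission where

open import Defs

open import Algebra.Bundles using (CommutativeMonoid)
open import Data.Bool using (Bool; true; false; T; _∨_; if_then_else_)
open import Data.Bool.ListAction using (or)
open import Data.Bool.Properties using (∨-commutativeMonoid)
open import Data.Fin using (Fin; toℕ)
open import Data.List using (List; []; _∷_; _++_; map; concatMap; length; filterᵇ; replicate; zipWith; downFrom; applyUpTo)
open import Data.List.Membership.Propositional using (_∈_)
open import Data.List.Membership.Propositional.Properties using (∈-downFrom⁻)
open import Data.List.Properties using (map-++; map-replicate; length-zipWith; zipWith-replicate)
open import Data.List.Relation.Unary.Any using (here; there)
open import Data.Maybe using (just; nothing; is-nothing)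
open import Data.Nat
open import Data.Nat.Combinatorics using (_C_; nC1≡n; nCk+nC[k+1]≡[n+1]C[k+1])
open import Data.Nat.Induction using (<-wellFounded)
open import Data.Nat.Logarithm using (⌈log₂_⌉; ⌈log₂⌉-mono-≤)
open import Data.Nat.Logarithm.Core using (⌈log2⌉)
open import Data.Nat.Properties
open import Data.Nat.Tactic.RingSolver using (solve-∀)
open import Data.Product using (_,_; proj₁)
open import Data.Vec using (Vec; []; _∷_)
open import Function using (_∘_)
open import Induction.WellFounded using (Acc; acc)
open import Level using (0ℓ)
open import Relation.Binary.Core using (Rel)
open import Relation.Binary.Definitions using (Decidable)
open import Relation.Binary.PropositionalEquality
open import Relation.Binary.Structures using (IsPartialOrder)
open import Relation.Nullary using (yes; no; contradiction)
open import Relation.Nullary.Decidable using (dec-true; dec-false; toWitness; T?)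

open import Algebra.Properties.CommutativeSemigroup +-commutativeSemigroup
  using () renaming (interchange to +-interchange)
open import Algebra.Properties.CommutativeSemigroup (CommutativeMonoid.commutativeSemigroup ∨-commutativeMonoid)
  using () renaming (interchange to ∨-interchange)

∑ : {A : Set} → List A → (A → ℕ) → ℕ
∑ []       f = 0
∑ (x ∷ xs) f = f x + ∑ xs f

syntax ∑ xs (λ x → e) = ∑[ x ∈ xs ] e

𝟙 : Bool → ℕ
𝟙 true  = 1
𝟙 false = 0

module _ {A : Set} {f g : A → ℕ} where

  ∑-cong : (∀ x → f x ≡ g x) → ∀ xs → ∑ xs f ≡ ∑ xs g
  ∑-cong f≗g []       = refl
  ∑-cong f≗g (x ∷ xs) = cong₂ _+_ (f≗g x) (∑-cong f≗g xs)

  ∑-mono-∈ : ∀ {xs} → (∀ {x} → x ∈ xs → f x ≤ g x) → ∑ xs f ≤ ∑ xs g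
  ∑-mono-∈ {[]}     f≤g = z≤n
  ∑-mono-∈ {x ∷ xs} f≤g = +-mono-≤ (f≤g (here refl)) (∑-mono-∈ (f≤g ∘ there))

  ∑-cong-∈ : ∀ {xs} → (∀ {x} → x ∈ xs → f x ≡ g x) → ∑ xs f ≡ ∑ xs g
  ∑-cong-∈ {[]}     f≗g = refl
  ∑-cong-∈ {x ∷ xs} f≗g = cong₂ _+_ (f≗g (here refl)) (∑-cong-∈ (f≗g ∘ there))

  ∑-mono : (∀ x → f x ≤ g x) → ∀ xs → ∑ xs f ≤ ∑ xs g
  ∑-mono f≤g xs = ∑-mono-∈ {xs} (λ {x} _ → f≤g x)

  ∑-distrib-+ : ∀ xs → ∑[ x ∈ xs ] (f x + g x) ≡ ∑ xs f + ∑ xs g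
  ∑-distrib-+ []       = refl
  ∑-distrib-+ (x ∷ xs) =
    trans (cong (f x + g x +_) (∑-distrib-+ xs)) (+-interchange (f x) (g x) (∑ xs f) (∑ xs g))

∑-distribˡ-* : ∀ {A : Set} c (f : A → ℕ) xs → ∑[ x ∈ xs ] (c * f x) ≡ c * ∑ xs f
∑-distribˡ-* c f []       = sym (*-zeroʳ c)
∑-distribˡ-* c f (x ∷ xs) =
  trans (cong (c * f x +_) (∑-distribˡ-* c f xs)) (sym (*-distribˡ-+ c (f x) (∑ xs f)))

∑-const : ∀ {A : Set} c (xs : List A) → ∑[ _ ∈ xs ] c ≡ length xs * c
∑-const c []       = refl
∑-const c (x ∷ xs) = cong (c +_) (∑-const c xs)

∑-++ : ∀ {A : Set} (f : A → ℕ) xs ys → ∑ (xs ++ ys) f ≡ ∑ xs f + ∑ ys f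
∑-++ f []       ys = refl
∑-++ f (x ∷ xs) ys = trans (cong (f x +_) (∑-++ f xs ys)) (sym (+-assoc (f x) _ _))

∑-map : ∀ {A B : Set} (f : B → ℕ) (g : A → B) xs → ∑ (map g xs) f ≡ ∑ xs (f ∘ g)
∑-map f g []       = refl
∑-map f g (x ∷ xs) = cong (f (g x) +_) (∑-map f g xs)

∑-concatMap : ∀ {A B : Set} (f : B → ℕ) (g : A → List B) xs →
              ∑ (concatMap g xs) f ≡ ∑[ x ∈ xs ] ∑ (g x) f
∑-concatMap f g []       = refl
∑-concatMap f g (x ∷ xs) =
  trans (∑-++ f (g x) (concatMap g xs)) (cong (∑ (g x) f +_) (∑-concatMap f g xs))

∑-comm : ∀ {A B : Set} (f : A → B → ℕ) xs ys →
         ∑[ x ∈ xs ] ∑[ y ∈ ys ] f x y ≡ ∑[ y ∈ ys ] ∑[ x ∈ xs ] f x y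
∑-comm f []       ys = sym (trans (∑-const 0 ys) (*-zeroʳ (length ys)))
∑-comm f (x ∷ xs) ys = trans (cong (∑ ys (f x) +_) (∑-comm f xs ys))
                             (sym (∑-distrib-+ ys))

length-filterᵇ : ∀ {A : Set} (p : A → Bool) xs → length (filterᵇ p xs) ≡ ∑[ x ∈ xs ] 𝟙 (p x)
length-filterᵇ p []       = refl
length-filterᵇ p (x ∷ xs) with p x
... | true  = cong suc (length-filterᵇ p xs)
... | false = length-filterᵇ p xs

∑-allVecs : ∀ {A : Set} (X : List A) m (f : Vec A (suc m) → ℕ) →
            ∑ (allVecs X (suc m)) f ≡ ∑[ x ∈ X ] ∑[ v ∈ allVecs X m ] f (x ∷ v)
∑-allVecs X m f = trans (∑-concatMap f (λ x → map (x ∷_) (allVecs X m)) X)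
                        (∑-cong (λ x → ∑-map f (x ∷_) (allVecs X m)) X)

length-allVecs : ∀ {A : Set} (X : List A) m → length (allVecs X m) ≡ length X ^ m
length-allVecs X zero    = refl
length-allVecs X (suc m) = begin
  length (allVecs X (suc m))         ≡⟨ count (allVecs X (suc m)) ⟨
  ∑[ _ ∈ allVecs X (suc m) ] 1       ≡⟨ ∑-allVecs X m (λ _ → 1) ⟩
  ∑[ _ ∈ X ] ∑[ _ ∈ allVecs X m ] 1  ≡⟨ ∑-cong (λ _ → trans (count (allVecs X m)) (length-allVecs X m)) X ⟩
  ∑[ _ ∈ X ] (length X ^ m)          ≡⟨ ∑-const (length X ^ m) X ⟩
  length X * length X ^ m            ∎
  where
  open ≡-Reasoning
  count : ∀ {E : Set} (xs : List E) → ∑[ _ ∈ xs ] 1 ≡ length xs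
  count xs = trans (∑-const 1 xs) (*-identityʳ (length xs))

-- Star patterns

Pattern : Set
Pattern = List Bool

swapᵖ : ℕ → Bool → Pattern → Pattern
swapᵖ (suc zero)    c (x ∷ y ∷ P) = if c then y ∷ x ∷ P else x ∷ y ∷ P
swapᵖ (suc (suc i)) c (x ∷ P)     = x ∷ swapᵖ (suc i) c P
swapᵖ _             _ P           = P

fillᵖ : Pattern → Pattern
fillᵖ []          = []
fillᵖ (_ ∷ [])    = false ∷ []
fillᵖ (x ∷ y ∷ P) = x ∷ fillᵖ (y ∷ P)

sweepᵖ : ℕ → ∀ {m} → Vec Bool m → Pattern → Pattern
sweepᵖ i []       P = P
sweepᵖ i (c ∷ cs) P = sweepᵖ (suc i) cs (fillᵖ (swapᵖ i c P))

runᵖ : ∀ {m t} → Vec (Vec Bool m) t → Pattern → Pattern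
runᵖ []         P = P
runᵖ (cs ∷ css) P = runᵖ css (sweepᵖ 1 cs P)

infixr 6 _∨ᵖ_
_∨ᵖ_ : Pattern → Pattern → Pattern
_∨ᵖ_ = zipWith _∨_

record IsLinear (f : Pattern → Pattern) : Set where
  field
    length-pres : ∀ P → length (f P) ≡ length P
    ∨ᵖ-hom      : ∀ P Q → length P ≡ length Q → f (P ∨ᵖ Q) ≡ f P ∨ᵖ f Q

open IsLinear

id-linear : IsLinear (λ P → P)
id-linear = record { length-pres = λ _ → refl ; ∨ᵖ-hom = λ _ _ _ → refl }

∘-linear : ∀ {f g} → IsLinear f → IsLinear g → IsLinear (f ∘ g)
∘-linear {f} {g} F G = record
  { length-pres = λ P → trans (length-pres F (g P)) (length-pres G P)
  ; ∨ᵖ-hom      = λ P Q |P|≡|Q| →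
      trans (cong f (∨ᵖ-hom G P Q |P|≡|Q|))
            (∨ᵖ-hom F (g P) (g Q) (trans (length-pres G P) (trans |P|≡|Q| (sym (length-pres G Q)))))
  }

length-swapᵖ : ∀ i c P → length (swapᵖ i c P) ≡ length P
length-swapᵖ (suc zero)    true  (x ∷ y ∷ P) = refl
length-swapᵖ (suc zero)    false (x ∷ y ∷ P) = refl
length-swapᵖ (suc zero)    c     []          = refl
length-swapᵖ (suc zero)    c     (x ∷ [])    = refl
length-swapᵖ (suc (suc i)) c     (x ∷ P)     = cong suc (length-swapᵖ (suc i) c P)
length-swapᵖ (suc (suc i)) c     []          = refl
length-swapᵖ zero          c     P           = refl

swapᵖ-∨ᵖ : ∀ i c P Q → length P ≡ length Q → swapᵖ i c (P ∨ᵖ Q) ≡ swapᵖ i c P ∨ᵖ swapᵖ i c Q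
swapᵖ-∨ᵖ (suc zero)    true  (x ∷ y ∷ P) (u ∷ v ∷ Q) _ = refl
swapᵖ-∨ᵖ (suc zero)    false (x ∷ y ∷ P) (u ∷ v ∷ Q) _ = refl
swapᵖ-∨ᵖ (suc zero)    c     []          []          _ = refl
swapᵖ-∨ᵖ (suc zero)    c     (x ∷ [])    (u ∷ [])    _ = refl
swapᵖ-∨ᵖ (suc (suc i)) c     (x ∷ P)     (u ∷ Q)     e = cong ((x ∨ u) ∷_) (swapᵖ-∨ᵖ (suc i) c P Q (suc-injective e))
swapᵖ-∨ᵖ (suc (suc i)) c     []          []          _ = refl
swapᵖ-∨ᵖ zero          c     P           Q           _ = refl

swapᵖ-linear : ∀ i c → IsLinear (swapᵖ i c)
swapᵖ-linear i c = record { length-pres = length-swapᵖ i c ; ∨ᵖ-hom = swapᵖ-∨ᵖ i c }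

length-fillᵖ : ∀ P → length (fillᵖ P) ≡ length P
length-fillᵖ []          = refl
length-fillᵖ (x ∷ [])    = refl
length-fillᵖ (x ∷ y ∷ P) = cong suc (length-fillᵖ (y ∷ P))

fillᵖ-∨ᵖ : ∀ P Q → length P ≡ length Q → fillᵖ (P ∨ᵖ Q) ≡ fillᵖ P ∨ᵖ fillᵖ Q
fillᵖ-∨ᵖ []          []          _ = refl
fillᵖ-∨ᵖ (x ∷ [])    (u ∷ [])    _ = refl
fillᵖ-∨ᵖ (x ∷ y ∷ P) (u ∷ v ∷ Q) e = cong ((x ∨ u) ∷_) (fillᵖ-∨ᵖ (y ∷ P) (v ∷ Q) (suc-injective e))

fillᵖ-linear : IsLinear fillᵖ
fillᵖ-linear = record { length-pres = length-fillᵖ ; ∨ᵖ-hom = fillᵖ-∨ᵖ }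

sweepᵖ-linear : ∀ i {m} (cs : Vec Bool m) → IsLinear (sweepᵖ i cs)
sweepᵖ-linear i []       = id-linear
sweepᵖ-linear i (c ∷ cs) = ∘-linear (sweepᵖ-linear (suc i) cs) (∘-linear fillᵖ-linear (swapᵖ-linear i c))

runᵖ-linear : ∀ {m t} (css : Vec (Vec Bool m) t) → IsLinear (runᵖ css)
runᵖ-linear []         = id-linear
runᵖ-linear (cs ∷ css) = ∘-linear (runᵖ-linear css) (sweepᵖ-linear 1 cs)

or-∨ᵖ : ∀ P Q → length P ≡ length Q → or (P ∨ᵖ Q) ≡ or P ∨ or Q
or-∨ᵖ []      []      _ = refl
or-∨ᵖ (x ∷ P) (u ∷ Q) e =
  trans (cong ((x ∨ u) ∨_) (or-∨ᵖ P Q (suc-injective e))) (∨-interchange x u (or P) (or Q))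

𝟙-∨ : ∀ a b → 𝟙 (a ∨ b) ≤ 𝟙 a + 𝟙 b
𝟙-∨ true  b = s≤s z≤n
𝟙-∨ false b = ≤-refl

-- The only star of singleton m p is at (1-based) position p; singleton m 0 has none.
singleton : ℕ → ℕ → Pattern
singleton zero    p = []
singleton (suc m) p = (p ≡ᵇ 1) ∷ singleton m (pred p)

length-singleton : ∀ m p → length (singleton m p) ≡ m
length-singleton zero    p = refl
length-singleton (suc m) p = cong suc (length-singleton m (pred p))

singleton-zero : ∀ m → singleton m 0 ≡ replicate m false
singleton-zero zero    = refl
singleton-zero (suc m) = cong (false ∷_) (singleton-zero m)

starsUpTo : ℕ → ℕ → Pattern
starsUpTo m zero    = singleton m 0
starsUpTo m (suc k) = singleton m (suc k) ∨ᵖ starsUpTo m k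

length-starsUpTo : ∀ m k → length (starsUpTo m k) ≡ m
length-starsUpTo m zero    = length-singleton m 0
length-starsUpTo m (suc k) = begin
  length (singleton m (suc k) ∨ᵖ starsUpTo m k)             ≡⟨ length-zipWith _∨_ (singleton m (suc k)) _ ⟩
  length (singleton m (suc k)) ⊓ length (starsUpTo m k)     ≡⟨ cong₂ _⊓_ (length-singleton m (suc k)) (length-starsUpTo m k) ⟩
  m ⊓ m                                                     ≡⟨ ⊓-idem m ⟩
  m                                                         ∎
  where open ≡-Reasoning

starsUpTo-replicate : ∀ {k m} → k ≤ m → starsUpTo m k ≡ replicate k true ++ replicate (m ∸ k) false
starsUpTo-replicate {zero}  _   = singleton-zero _
starsUpTo-replicate {suc k} k<m = trans (cong (singleton _ (suc k) ∨ᵖ_) (starsUpTo-replicate (<⇒≤ k<m)))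
                                        (add-star k<m)
  where
  add-star : ∀ {k m} → k < m → singleton m (suc k) ∨ᵖ (replicate k true ++ replicate (m ∸ k) false)
                                ≡ replicate (suc k) true ++ replicate (m ∸ suc k) false
  add-star {zero}  {suc m} _         = cong (true ∷_) (trans (cong (_∨ᵖ replicate m false) (singleton-zero m))
                                                             (zipWith-replicate m _∨_ false false))
  add-star {suc k} {suc m} (s≤s k<m) = cong (true ∷_) (add-star k<m)

union-bound : ∀ {f} → IsLinear f → ∀ m k →
              𝟙 (or (f (starsUpTo m k))) ≤ ∑[ p ∈ downFrom (suc k) ] 𝟙 (or (f (singleton m p)))
union-bound F m zero    = m≤m+n _ 0
union-bound {f} F m (suc k) = begin
  𝟙 (or (f (S ∨ᵖ R)))                                         ≡⟨ cong (𝟙 ∘ or) (∨ᵖ-hom F S R |S|≡|R|) ⟩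
  𝟙 (or (f S ∨ᵖ f R))                                         ≡⟨ cong 𝟙 (or-∨ᵖ (f S) (f R) |fS|≡|fR|) ⟩
  𝟙 (or (f S) ∨ or (f R))                                     ≤⟨ 𝟙-∨ (or (f S)) (or (f R)) ⟩
  𝟙 (or (f S)) + 𝟙 (or (f R))                                 ≤⟨ +-monoʳ-≤ _ (union-bound F m k) ⟩
  ∑[ p ∈ downFrom (suc (suc k)) ] 𝟙 (or (f (singleton m p)))  ∎
  where
  open ≤-Reasoning
  S = singleton m (suc k)
  R = starsUpTo m k
  |S|≡|R| : length S ≡ length R
  |S|≡|R| = trans (length-singleton m (suc k)) (sym (length-starsUpTo m k))
  |fS|≡|fR| : length (f S) ≡ length (f R)
  |fS|≡|fR| = trans (length-pres F S) (trans |S|≡|R| (sym (length-pres F R)))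

module StarPattern (n : ℕ) (_⪯_ : Rel (Fin n) 0ℓ) (_⪯?_ : Decidable _⪯_) where
  open Chain n _⪯_ _⪯?_

  stars : List Entry → Pattern
  stars = map is-nothing

  -- A swap can only be blocked between two numbers, which look alike in the star pattern.
  stars-condSwap : ∀ i c r → stars (condSwap i c r) ≡ swapᵖ i c (stars r)
  stars-condSwap (suc zero)    false (x ∷ y ∷ r)            = refl
  stars-condSwap (suc zero)    true  (just a ∷ just b ∷ r)  with comparable (just a) (just b)
  ... | false = refl
  ... | true  = refl
  stars-condSwap (suc zero)    true  (nothing ∷ y ∷ r)      = refl
  stars-condSwap (suc zero)    true  (just a ∷ nothing ∷ r) = refl
  stars-condSwap (suc zero)    c     []                     = refl
  stars-condSwap (suc zero)    c     (x ∷ [])               = refl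
  stars-condSwap (suc (suc i)) c     (x ∷ r)                = cong (is-nothing x ∷_) (stars-condSwap (suc i) c r)
  stars-condSwap (suc (suc i)) c     []                     = refl
  stars-condSwap zero          c     r                      = refl

  stars-fillLast : ∀ r k → stars (proj₁ (fillLast r k)) ≡ fillᵖ (stars r)
  stars-fillLast []                k = refl
  stars-fillLast (nothing ∷ [])    k = refl
  stars-fillLast (just _ ∷ [])     k = refl
  stars-fillLast (nothing ∷ y ∷ r) k = cong (true ∷_) (stars-fillLast (y ∷ r) k)
  stars-fillLast (just _ ∷ y ∷ r)  k = cong (false ∷_) (stars-fillLast (y ∷ r) k)

  stars-sweepFrom : ∀ i {m} (cs : Vec Bool m) s →
                    stars (proj₁ (sweepFrom i cs s)) ≡ sweepᵖ i cs (stars (proj₁ s))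
  stars-sweepFrom i []       s       = refl
  stars-sweepFrom i (c ∷ cs) (r , k) = begin
    stars (proj₁ (sweepFrom (suc i) cs (B (r , k) i c)))    ≡⟨ stars-sweepFrom (suc i) cs (B (r , k) i c) ⟩
    sweepᵖ (suc i) cs (stars (proj₁ (B (r , k) i c)))        ≡⟨ cong (sweepᵖ (suc i) cs) (stars-fillLast (condSwap i c r) k) ⟩
    sweepᵖ (suc i) cs (fillᵖ (stars (condSwap i c r)))       ≡⟨ cong (sweepᵖ (suc i) cs ∘ fillᵖ) (stars-condSwap i c r) ⟩
    sweepᵖ (suc i) cs (fillᵖ (swapᵖ i c (stars r)))          ∎
    where open ≡-Reasoning

  stars-run : ∀ {t} (css : Vec (Vec Bool (n ∸ 1)) t) s →
              stars (proj₁ (run css s)) ≡ runᵖ css (stars (proj₁ s))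
  stars-run []         s = refl
  stars-run (cs ∷ css) s = trans (stars-run css (sweep cs s)) (cong (runᵖ css) (stars-sweepFrom 1 cs s))

  stars-y₀ : 1 ≤ n → stars (proj₁ y₀) ≡ starsUpTo n (n ∸ 1)
  stars-y₀ 1≤n = begin
    map is-nothing (replicate k nothing ++ just 1 ∷ [])  ≡⟨ map-++ is-nothing (replicate k nothing) _ ⟩
    map is-nothing (replicate k nothing) ++ false ∷ []   ≡⟨ cong (_++ false ∷ []) (map-replicate is-nothing k nothing) ⟩
    replicate k true ++ replicate 1 false                 ≡⟨ cong (λ j → replicate k true ++ replicate j false) (m∸[m∸n]≡n 1≤n) ⟨
    replicate k true ++ replicate (n ∸ k) false           ≡⟨ starsUpTo-replicate (m∸n≤m n 1) ⟨
    starsUpTo n k                                         ∎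
    where
    open ≡-Reasoning
    k = n ∸ 1

-- A single star

+-suc-≤ : ∀ {i m n} → i + suc m ≤ n → suc i + m ≤ n
+-suc-≤ {i} {m} = ≤-trans (≤-reflexive (sym (+-suc i m)))

+-suc-≤⇒≤ : ∀ {i m n} → i + suc m ≤ n → suc i ≤ n
+-suc-≤⇒≤ {i} {m} i+m≤n = ≤-trans (m≤m+n (suc i) m) (+-suc-≤ i+m≤n)

-- A star is tracked by its 1-based position; 0 means it has been replaced by a number.
transpose : ℕ → ℕ → ℕ
transpose zero    zero          = 1
transpose zero    (suc zero)    = 0
transpose zero    (suc (suc p)) = suc (suc p)
transpose (suc i) zero          = zero
transpose (suc i) (suc p)       = suc (transpose i p)

swapPos : ℕ → Bool → ℕ → ℕ
swapPos i true  = transpose i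
swapPos i false p = p

fillPos : ℕ → ℕ → ℕ
fillPos n p = if p ≡ᵇ n then 0 else p

stepPos : ℕ → ℕ → Bool → ℕ → ℕ
stepPos n i c p = fillPos n (swapPos i c p)

sweepPos : ℕ → ℕ → ∀ {m} → Vec Bool m → ℕ → ℕ
sweepPos n i []       p = p
sweepPos n i (c ∷ cs) p = sweepPos n (suc i) cs (stepPos n i c p)

runPos : ∀ n {m t} → Vec (Vec Bool m) t → ℕ → ℕ
runPos n []         p = p
runPos n (cs ∷ css) p = runPos n css (sweepPos n 1 cs p)

swapᵖ-singleton : ∀ i c {m} p → suc i < m → swapᵖ (suc i) c (singleton m p) ≡ singleton m (swapPos (suc i) c p)
swapᵖ-singleton zero    c     {suc zero}    p                   (s≤s ())
swapᵖ-singleton zero    false {suc (suc m)} p                   _         = refl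
swapᵖ-singleton zero    true  {suc (suc m)} zero                _         = refl
swapᵖ-singleton zero    true  {suc (suc m)} (suc zero)          _         = refl
swapᵖ-singleton zero    true  {suc (suc m)} (suc (suc zero))    _         = refl
swapᵖ-singleton zero    true  {suc (suc m)} (suc (suc (suc p))) _         = refl
swapᵖ-singleton (suc i) false {suc m}       p                   (s≤s 1+i<m) =
  cong ((p ≡ᵇ 1) ∷_) (swapᵖ-singleton i false (pred p) 1+i<m)
swapᵖ-singleton (suc i) true  {suc m}       zero                (s≤s 1+i<m) =
  cong (false ∷_) (swapᵖ-singleton i true zero 1+i<m)
swapᵖ-singleton (suc i) true  {suc m}       (suc zero)          (s≤s 1+i<m) =
  cong (true ∷_) (swapᵖ-singleton i true zero 1+i<m)
swapᵖ-singleton (suc i) true  {suc m}       (suc (suc p))       (s≤s 1+i<m) =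
  cong (false ∷_) (swapᵖ-singleton i true (suc p) 1+i<m)

fillᵖ-singleton : ∀ m p → fillᵖ (singleton (suc m) p) ≡ singleton (suc m) (fillPos (suc m) p)
fillᵖ-singleton zero    p with p ≡ᵇ 1 in p≟1
... | true  = refl
... | false = cong (_∷ []) (sym p≟1)
fillᵖ-singleton (suc m) zero          = cong (false ∷_) (fillᵖ-singleton m zero)
fillᵖ-singleton (suc m) (suc zero)    = cong (true ∷_) (fillᵖ-singleton m zero)
fillᵖ-singleton (suc m) (suc (suc p)) with fillᵖ-singleton m (suc p)
... | ih with p ≡ᵇ m
...   | true  = cong (false ∷_) ih
...   | false = cong (false ∷_) ih

sweepᵖ-singleton : ∀ n i {m} (cs : Vec Bool m) p → suc i + m ≤ n →
                   sweepᵖ (suc i) cs (singleton n p) ≡ singleton n (sweepPos n (suc i) cs p)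
sweepᵖ-singleton n       i []       p _ = refl
sweepᵖ-singleton (suc n) i {suc m} (c ∷ cs) p i+m≤n = begin
  sweepᵖ (suc (suc i)) cs (fillᵖ (swapᵖ (suc i) c (singleton (suc n) p)))
    ≡⟨ cong (sweepᵖ (suc (suc i)) cs ∘ fillᵖ) (swapᵖ-singleton i c p (+-suc-≤⇒≤ {suc i} i+m≤n)) ⟩
  sweepᵖ (suc (suc i)) cs (fillᵖ (singleton (suc n) (swapPos (suc i) c p)))
    ≡⟨ cong (sweepᵖ (suc (suc i)) cs) (fillᵖ-singleton n (swapPos (suc i) c p)) ⟩
  sweepᵖ (suc (suc i)) cs (singleton (suc n) (stepPos (suc n) (suc i) c p))
    ≡⟨ sweepᵖ-singleton (suc n) (suc i) cs _ (+-suc-≤ {suc i} i+m≤n) ⟩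
  singleton (suc n) (sweepPos (suc n) (suc (suc i)) cs (stepPos (suc n) (suc i) c p))
    ∎
  where open ≡-Reasoning

runᵖ-singleton : ∀ n {t} (css : Vec (Vec Bool (n ∸ 1)) t) p → 1 ≤ n →
                 runᵖ css (singleton n p) ≡ singleton n (runPos n css p)
runᵖ-singleton n []         p _   = refl
runᵖ-singleton n (cs ∷ css) p 1≤n =
  trans (cong (runᵖ css) (sweepᵖ-singleton n 0 cs p (≤-reflexive (m+[n∸m]≡n 1≤n))))
        (runᵖ-singleton n css _ 1≤n)

alive : ℕ → ℕ
alive zero    = 0
alive (suc _) = 1

𝟙-or-singleton : ∀ m p → 𝟙 (or (singleton m p)) ≤ alive p
𝟙-or-singleton zero    zero    = z≤n
𝟙-or-singleton (suc m) zero    = 𝟙-or-singleton m zero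
𝟙-or-singleton m       (suc p) = 𝟙≤1 (or (singleton m (suc p)))
  where
  𝟙≤1 : ∀ b → 𝟙 b ≤ 1
  𝟙≤1 true  = ≤-refl
  𝟙≤1 false = z≤n

transpose-< : ∀ {i p} → p < i → transpose i p ≡ p
transpose-< {suc i} {zero}  _         = refl
transpose-< {suc i} {suc p} (s≤s p<i) = cong suc (transpose-< p<i)

transpose-> : ∀ {i p} → suc i < p → transpose i p ≡ p
transpose-> {zero}  {suc zero}    (s≤s ())
transpose-> {zero}  {suc (suc p)} _         = refl
transpose-> {suc i} {suc p}       (s≤s i<p) = cong suc (transpose-> i<p)

transpose-left : ∀ i → transpose i i ≡ suc i
transpose-left zero    = refl
transpose-left (suc i) = cong suc (transpose-left i)

transpose-right : ∀ i → transpose i (suc i) ≡ i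
transpose-right zero    = refl
transpose-right (suc i) = cong suc (transpose-right i)

transpose-≤ : ∀ {i p n} → suc i ≤ n → p ≤ n → transpose i p ≤ n
transpose-≤ {zero}  {zero}        1≤n _   = 1≤n
transpose-≤ {zero}  {suc zero}    _   _   = z≤n
transpose-≤ {zero}  {suc (suc p)} _   p≤n = p≤n
transpose-≤ {suc i} {zero}        _   _   = z≤n
transpose-≤ {suc i} {suc p} (s≤s i<n) (s≤s p≤n) = s≤s (transpose-≤ i<n p≤n)

fillPos-≢ : ∀ {n p} → p ≢ n → fillPos n p ≡ p
fillPos-≢ {n} {p} p≢n = cong (if_then 0 else p) (dec-false (p ≟ n) p≢n)

fillPos-self : ∀ n → fillPos n n ≡ 0
fillPos-self n = cong (if_then 0 else n) (dec-true (n ≟ n) refl)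

fillPos-< : ∀ {n q} → 0 < n → q ≤ n → fillPos n q < n
fillPos-< {n} {q} 0<n q≤n with q ≟ n
... | yes refl = subst (_< n) (sym (fillPos-self n)) 0<n
... | no  q≢n  = subst (_< n) (sym (fillPos-≢ q≢n)) (≤∧≢⇒< q≤n q≢n)

swapPos-≤ : ∀ {i p n} c → suc i ≤ n → p ≤ n → swapPos i c p ≤ n
swapPos-≤ true  = transpose-≤
swapPos-≤ false _ p≤n = p≤n

swapPos-< : ∀ {i p} c → p < i → swapPos i c p ≡ p
swapPos-< true  = transpose-<
swapPos-< false _ = refl

swapPos-> : ∀ {i p} c → suc i < p → swapPos i c p ≡ p
swapPos-> true  = transpose->
swapPos-> false _ = refl

stepPos-< : ∀ {n i p} c → suc i ≤ n → p < n → stepPos n i c p < n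
stepPos-< c 1+i≤n p<n = fillPos-< (≤-trans (s≤s z≤n) p<n) (swapPos-≤ c 1+i≤n (<⇒≤ p<n))

stepPos-far : ∀ {n i p} c → suc i < p → p < n → stepPos n i c p ≡ p
stepPos-far c 1+i<p p<n = trans (cong (fillPos _) (swapPos-> c 1+i<p)) (fillPos-≢ (<⇒≢ p<n))

stepPos-stay : ∀ {n i p} → p < n → stepPos n i false p ≡ p
stepPos-stay p<n = fillPos-≢ (<⇒≢ p<n)

stepPos-advance : ∀ {n i} → suc i < n → stepPos n i true i ≡ suc i
stepPos-advance {i = i} 1+i<n = trans (cong (fillPos _) (transpose-left i)) (fillPos-≢ (<⇒≢ 1+i<n))

stepPos-exit : ∀ {n i} → suc i ≡ n → stepPos n i true i ≡ 0
stepPos-exit {i = i} refl = trans (cong (fillPos _) (transpose-left i)) (fillPos-self (suc i))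

stepPos-retreat : ∀ {n i} → suc i < n → stepPos n i true (suc i) ≡ i
stepPos-retreat {i = i} 1+i<n = trans (cong (fillPos _) (transpose-right i)) (fillPos-≢ (<⇒≢ (<⇒≤ 1+i<n)))

sweepPos-< : ∀ {n} i {m} (cs : Vec Bool m) {p} → i + m ≤ n → p < n → sweepPos n i cs p < n
sweepPos-< i []               _     p<n = p<n
sweepPos-< i (c ∷ cs) i+m≤n p<n = sweepPos-< (suc i) cs (+-suc-≤ i+m≤n) (stepPos-< c (+-suc-≤⇒≤ i+m≤n) p<n)

sweepPos-frozen : ∀ {n} i {m} (cs : Vec Bool m) {p} → p < i → p < n → sweepPos n i cs p ≡ p
sweepPos-frozen i []       _   _   = refl
sweepPos-frozen i (c ∷ cs) p<i p<n =
  trans (cong (sweepPos _ (suc i) cs) (trans (cong (fillPos _) (swapPos-< c p<i)) (fillPos-≢ (<⇒≢ p<n))))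
        (sweepPos-frozen (suc i) cs (m≤n⇒m≤1+n p<i) p<n)

runPos-< : ∀ {n t} (css : Vec (Vec Bool (n ∸ 1)) t) {p} → p < n → runPos n css p < n
runPos-< []         p<n = p<n
runPos-< (cs ∷ css) p<n = runPos-< css (sweepPos-< 1 cs (≤-reflexive (m+[n∸m]≡n (≤-trans (s≤s z≤n) p<n))) p<n)

coinVecs : ∀ m → List (Vec Bool m)
coinVecs = allVecs (true ∷ false ∷ [])

∑-coinVecs : ∀ m (f : Vec Bool (suc m) → ℕ) →
             ∑ (coinVecs (suc m)) f ≡ ∑[ cs ∈ coinVecs m ] f (true ∷ cs) + ∑[ cs ∈ coinVecs m ] f (false ∷ cs)
∑-coinVecs m f = trans (∑-allVecs _ m f) (cong (∑[ cs ∈ coinVecs m ] f (true ∷ cs) +_) (+-identityʳ _))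

length-coinVecs : ∀ m → length (coinVecs m) ≡ 2 ^ m
length-coinVecs = length-allVecs (true ∷ false ∷ [])

module Sweeps (n : ℕ) where

  D : ℕ
  D = 2 ^ (n ∸ 1)

  sweepSumFrom : ℕ → ℕ → (ℕ → ℕ) → ℕ → ℕ
  sweepSumFrom i m f p = ∑[ cs ∈ coinVecs m ] f (sweepPos n i cs p)

  sweepSum : (ℕ → ℕ) → ℕ → ℕ
  sweepSum = sweepSumFrom 1 (n ∸ 1)

  runSum : ℕ → (ℕ → ℕ) → ℕ → ℕ
  runSum t f p = ∑[ css ∈ allCoinSeqs n t ] f (runPos n css p)

  survivors : ℕ → ℕ
  survivors t = ∑[ p ∈ downFrom n ] runSum t alive p

  sweepSumFrom-step : ∀ i m f {p q r} → stepPos n i true p ≡ q → stepPos n i false p ≡ r →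
                      sweepSumFrom i (suc m) f p ≡ sweepSumFrom (suc i) m f q + sweepSumFrom (suc i) m f r
  sweepSumFrom-step i m f {p} refl refl = ∑-coinVecs m (λ cs → f (sweepPos n i cs p))

  sweepSumFrom-frozen : ∀ {i} m f {p} → p < i → p < n → sweepSumFrom i m f p ≡ 2 ^ m * f p
  sweepSumFrom-frozen {i} m f p<i p<n = begin
    ∑[ cs ∈ coinVecs m ] f (sweepPos n i cs _) ≡⟨ ∑-cong (λ cs → cong f (sweepPos-frozen i cs p<i p<n)) (coinVecs m) ⟩
    ∑[ _ ∈ coinVecs m ] f _                    ≡⟨ ∑-const _ (coinVecs m) ⟩
    length (coinVecs m) * f _                  ≡⟨ cong (_* f _) (length-coinVecs m) ⟩
    2 ^ m * f _                                ∎
    where open ≡-Reasoning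

  sweepSumFrom-far : ∀ {i} m f {p} → suc i < p → p < n → sweepSumFrom i (suc m) f p ≡ 2 * sweepSumFrom (suc i) m f p
  sweepSumFrom-far {i} m f 1+i<p p<n =
    trans (sweepSumFrom-step i m f (stepPos-far true 1+i<p p<n) (stepPos-far false 1+i<p p<n))
          (cong (sweepSumFrom (suc i) m f _ +_) (sym (+-identityʳ _)))

  sweepSumFrom-far⁺ : ∀ k {i} m f {p} → i + k < p → p < n →
                      sweepSumFrom i (k + m) f p ≡ 2 ^ k * sweepSumFrom (i + k) m f p
  sweepSumFrom-far⁺ zero    {i} m f _ _ =
    trans (cong (λ j → sweepSumFrom j m f _) (sym (+-identityʳ i))) (sym (+-identityʳ _))
  sweepSumFrom-far⁺ (suc k) {i} m f {p} i+k<p p<n = begin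
    sweepSumFrom i (suc k + m) f p                ≡⟨ sweepSumFrom-far (k + m) f (≤-trans (s≤s (s≤s (m≤m+n i k))) 1+i+k<p) p<n ⟩
    2 * sweepSumFrom (suc i) (k + m) f p          ≡⟨ cong (2 *_) (sweepSumFrom-far⁺ k m f 1+i+k<p p<n) ⟩
    2 * (2 ^ k * sweepSumFrom (suc i + k) m f p)  ≡⟨ *-assoc 2 (2 ^ k) _ ⟨
    2 ^ suc k * sweepSumFrom (suc i + k) m f p    ≡⟨ cong (λ j → 2 ^ suc k * sweepSumFrom j m f p) (+-suc i k) ⟨
    2 ^ suc k * sweepSumFrom (i + suc k) m f p    ∎
    where
    open ≡-Reasoning
    1+i+k<p : suc i + k < p
    1+i+k<p = ≤-trans (≤-reflexive (cong suc (sym (+-suc i k)))) i+k<p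

  sweepSumFrom-ahead : ∀ {i} m f → suc i < n →
                       sweepSumFrom i (suc m) f i ≡ sweepSumFrom (suc i) m f (suc i) + 2 ^ m * f i
  sweepSumFrom-ahead {i} m f 1+i<n =
    trans (sweepSumFrom-step i m f (stepPos-advance 1+i<n) (stepPos-stay {i = i} (<⇒≤ 1+i<n)))
          (cong (sweepSumFrom (suc i) m f (suc i) +_) (sweepSumFrom-frozen m f ≤-refl (<⇒≤ 1+i<n)))

  sweepSumFrom-behind : ∀ {i} m f → suc i < n →
                        sweepSumFrom i (suc m) f (suc i) ≡ 2 ^ m * f i + sweepSumFrom (suc i) m f (suc i)
  sweepSumFrom-behind {i} m f 1+i<n =
    trans (sweepSumFrom-step i m f (stepPos-retreat 1+i<n) (stepPos-stay {i = i} 1+i<n))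
          (cong (_+ sweepSumFrom (suc i) m f (suc i)) (sweepSumFrom-frozen m f ≤-refl (<⇒≤ 1+i<n)))

  -- A star at j meets the steps j, j+1, … of the last d coins: coin 0 leaves it behind for good,
  -- coin 1 carries it one place on, and carried to position n it is replaced (f 0).
  exitSum : (ℕ → ℕ) → ℕ → ℕ → ℕ
  exitSum f j zero    = f 0
  exitSum f j (suc d) = 2 ^ d * f j + exitSum f (suc j) d

  sweepSumFrom-exitSum : ∀ {j} m f → j + m ≡ n → j < n → sweepSumFrom j m f j ≡ exitSum f j m
  sweepSumFrom-exitSum {j} zero          f j+0≡n j<n = contradiction (trans (sym (+-identityʳ j)) j+0≡n) (<⇒≢ j<n)
  sweepSumFrom-exitSum {j} (suc zero)    f j+1≡n _   =
    trans (sweepSumFrom-step j 0 f (stepPos-exit 1+j≡n) (stepPos-stay {i = j} (≤-reflexive 1+j≡n))) (regroup (f 0) (f j))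
    where
    1+j≡n = trans (+-comm 1 j) j+1≡n
    regroup : ∀ x y → (x + 0) + (y + 0) ≡ 1 * y + x
    regroup = solve-∀
  sweepSumFrom-exitSum {j} (suc (suc d)) f j+m≡n _   = begin
    sweepSumFrom j (2 + d) f j                               ≡⟨ sweepSumFrom-ahead (suc d) f 1+j<n ⟩
    sweepSumFrom (suc j) (suc d) f (suc j) + 2 ^ suc d * f j
      ≡⟨ cong (_+ 2 ^ suc d * f j) (sweepSumFrom-exitSum (suc d) f 1+j+m≡n 1+j<n) ⟩
    exitSum f (suc j) (suc d) + 2 ^ suc d * f j              ≡⟨ +-comm _ (2 ^ suc d * f j) ⟩
    2 ^ suc d * f j + exitSum f (suc j) (suc d)              ∎
    where
    open ≡-Reasoning
    1+j+m≡n : suc j + suc d ≡ n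
    1+j+m≡n = trans (sym (+-suc j (suc d))) j+m≡n
    1+j<n : suc j < n
    1+j<n = ≤-trans (s≤s (s≤s (m≤m+n j d))) (≤-reflexive (trans (cong suc (sym (+-suc j d))) 1+j+m≡n))

  closedSweepSum : (ℕ → ℕ) → ℕ → ℕ
  closedSweepSum f zero          = D * f 0
  closedSweepSum f (suc zero)    = exitSum f 1 (n ∸ 1)
  closedSweepSum f (suc (suc k)) = 2 ^ k * (2 ^ c * f (suc k) + exitSum f (suc (suc k)) c)
    where c = n ∸ suc (suc k)

  sweepSum-closed : ∀ f {p} → p < n → sweepSum f p ≡ closedSweepSum f p
  sweepSum-closed f {zero}        0<n   = sweepSumFrom-frozen (n ∸ 1) f (s≤s z≤n) 0<n
  sweepSum-closed f {suc zero}    1<n   = sweepSumFrom-exitSum (n ∸ 1) f (m+[n∸m]≡n (<⇒≤ 1<n)) 1<n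
  sweepSum-closed f {suc (suc k)} 2+k<n = begin
    sweepSumFrom 1 (n ∸ 1) f (2 + k)                               ≡⟨ cong (λ m → sweepSumFrom 1 m f (2 + k)) n∸1≡k+1+c ⟩
    sweepSumFrom 1 (k + suc c) f (2 + k)                           ≡⟨ sweepSumFrom-far⁺ k (suc c) f ≤-refl 2+k<n ⟩
    2 ^ k * sweepSumFrom (suc k) (suc c) f (2 + k)                 ≡⟨ cong (2 ^ k *_) (sweepSumFrom-behind c f 2+k<n) ⟩
    2 ^ k * (2 ^ c * f (suc k) + sweepSumFrom (2 + k) c f (2 + k))
      ≡⟨ cong (λ x → 2 ^ k * (2 ^ c * f (suc k) + x)) (sweepSumFrom-exitSum c f 2+k+c≡n 2+k<n) ⟩
    2 ^ k * (2 ^ c * f (suc k) + exitSum f (2 + k) c)              ∎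
    where
    open ≡-Reasoning
    c = n ∸ suc (suc k)
    2+k+c≡n : 2 + k + c ≡ n
    2+k+c≡n = m+[n∸m]≡n (<⇒≤ 2+k<n)
    n∸1≡k+1+c : n ∸ 1 ≡ k + suc c
    n∸1≡k+1+c = trans (cong (_∸ 1) (sym 2+k+c≡n)) (sym (+-suc k c))

  sweepSum-cong-< : ∀ {f g} → (∀ {q} → q < n → f q ≡ g q) → ∀ {p} → p < n → sweepSum f p ≡ sweepSum g p
  sweepSum-cong-< f≗g p<n =
    ∑-cong (λ cs → f≗g (sweepPos-< 1 cs (≤-reflexive (m+[n∸m]≡n (≤-trans (s≤s z≤n) p<n))) p<n)) (coinVecs (n ∸ 1))

  runSum-zero : ∀ f p → runSum 0 f p ≡ f p
  runSum-zero f p = +-identityʳ (f p)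

  runSum-suc : ∀ t f p → runSum (suc t) f p ≡ sweepSum (runSum t f) p
  runSum-suc t f p = ∑-allVecs (coinVecs (n ∸ 1)) t (λ css → f (runPos n css p))

  runSum-+ : ∀ a b f p → runSum (a + b) f p ≡ runSum a (runSum b f) p
  runSum-+ zero    b f p = sym (runSum-zero (runSum b f) p)
  runSum-+ (suc a) b f p = begin
    runSum (suc a + b) f p              ≡⟨ runSum-suc (a + b) f p ⟩
    sweepSum (runSum (a + b) f) p       ≡⟨ ∑-cong (λ cs → runSum-+ a b f _) (coinVecs (n ∸ 1)) ⟩
    sweepSum (runSum a (runSum b f)) p  ≡⟨ runSum-suc a (runSum b f) p ⟨
    runSum (suc a) (runSum b f) p       ∎
    where open ≡-Reasoning

  runSum-mono-< : ∀ t {f g} → (∀ {q} → q < n → f q ≤ g q) → ∀ {p} → p < n → runSum t f p ≤ runSum t g p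
  runSum-mono-< t f≤g p<n = ∑-mono (λ css → f≤g (runPos-< css p<n)) (allCoinSeqs n t)

  runSum-cong-< : ∀ t {f g} → (∀ {q} → q < n → f q ≡ g q) → ∀ {p} → p < n → runSum t f p ≡ runSum t g p
  runSum-cong-< t f≗g p<n = ∑-cong (λ css → f≗g (runPos-< css p<n)) (allCoinSeqs n t)

  runSum-distrib-+ : ∀ t f g p → runSum t (λ q → f q + g q) p ≡ runSum t f p + runSum t g p
  runSum-distrib-+ t f g p = ∑-distrib-+ (allCoinSeqs n t)

  runSum-distribˡ-* : ∀ t c f p → runSum t (λ q → c * f q) p ≡ c * runSum t f p
  runSum-distribˡ-* t c f p = ∑-distribˡ-* c (λ css → f (runPos n css p)) (allCoinSeqs n t)

  runSum-sweepSum : ∀ t f p → runSum (suc t) f p ≡ runSum t (sweepSum f) p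
  runSum-sweepSum t f p = begin
    runSum (suc t) f p       ≡⟨ cong (λ s → runSum s f p) (+-comm 1 t) ⟩
    runSum (t + 1) f p       ≡⟨ runSum-+ t 1 f p ⟩
    runSum t (runSum 1 f) p  ≡⟨ ∑-cong (λ css → runSum-one (runPos n css p)) (allCoinSeqs n t) ⟩
    runSum t (sweepSum f) p  ∎
    where
    open ≡-Reasoning
    runSum-one : ∀ q → runSum 1 f q ≡ sweepSum f q
    runSum-one q = trans (runSum-suc 0 f q) (∑-cong (λ cs → runSum-zero f _) (coinVecs (n ∸ 1)))

badCount≤survivors : ∀ m (_⪯_ : Rel (Fin (suc m)) 0ℓ) (_⪯?_ : Decidable _⪯_) t →
                     badCount (suc m) _⪯_ _⪯?_ t ≤ Sweeps.survivors (suc m) t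
badCount≤survivors m _⪯_ _⪯?_ t = begin
  length (filterᵇ (λ css → hasStar (run css y₀)) seqs)                   ≡⟨ length-filterᵇ _ seqs ⟩
  ∑[ css ∈ seqs ] 𝟙 (hasStar (run css y₀))                               ≡⟨ ∑-cong (cong 𝟙 ∘ hasStar-run) seqs ⟩
  ∑[ css ∈ seqs ] 𝟙 (or (runᵖ css (starsUpTo n m)))                      ≤⟨ ∑-mono (λ css → union-bound (runᵖ-linear css) n m) seqs ⟩
  ∑[ css ∈ seqs ] ∑[ p ∈ downFrom n ] 𝟙 (or (runᵖ css (singleton n p)))  ≤⟨ ∑-mono (λ css → ∑-mono (survives css) (downFrom n)) seqs ⟩
  ∑[ css ∈ seqs ] ∑[ p ∈ downFrom n ] alive (runPos n css p)             ≡⟨ ∑-comm (λ css p → alive (runPos n css p)) seqs (downFrom n) ⟩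
  Sweeps.survivors n t                                                   ∎
  where
  open ≤-Reasoning
  open Chain (suc m) _⪯_ _⪯?_
  open StarPattern (suc m) _⪯_ _⪯?_
  n = suc m
  seqs = allCoinSeqs n t
  hasStar-run : ∀ css → hasStar (run css y₀) ≡ or (runᵖ css (starsUpTo n m))
  hasStar-run css = cong or (trans (stars-run css y₀) (cong (runᵖ css) (stars-y₀ (s≤s z≤n))))
  survives : ∀ css p → 𝟙 (or (runᵖ css (singleton n p))) ≤ alive (runPos n css p)
  survives css p = ≤-trans (≤-reflexive (cong (𝟙 ∘ or) (runᵖ-singleton n css p (s≤s z≤n))))
                           (𝟙-or-singleton n (runPos n css p))

-- The potential

rangeSum : ℕ → ℕ → ℕ
rangeSum a zero    = 0
rangeSum a (suc c) = a + rangeSum (suc a) c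

rangeSum-suffix≤ : ∀ k a c → rangeSum (k + a) (c ∸ k) ≤ rangeSum a c
rangeSum-suffix≤ zero    a c       = ≤-refl
rangeSum-suffix≤ (suc k) a zero    = z≤n
rangeSum-suffix≤ (suc k) a (suc c) = begin
  rangeSum (suc k + a) (c ∸ k) ≡⟨ cong (λ b → rangeSum b (c ∸ k)) (+-suc k a) ⟨
  rangeSum (k + suc a) (c ∸ k) ≤⟨ rangeSum-suffix≤ k (suc a) c ⟩
  rangeSum (suc a) c           ≤⟨ m≤n+m _ a ⟩
  a + rangeSum (suc a) c       ∎
  where open ≤-Reasoning

2*rangeSum+c≡c*[2a+c] : ∀ a c → 2 * rangeSum a c + c ≡ c * (2 * a + c)
2*rangeSum+c≡c*[2a+c] a zero    = refl
2*rangeSum+c≡c*[2a+c] a (suc c) = begin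
  2 * (a + rangeSum (suc a) c) + suc c      ≡⟨ regroup a (rangeSum (suc a) c) c ⟩
  2 * a + (2 * rangeSum (suc a) c + c) + 1  ≡⟨ cong (λ x → 2 * a + x + 1) (2*rangeSum+c≡c*[2a+c] (suc a) c) ⟩
  2 * a + c * (2 * suc a + c) + 1           ≡⟨ expand a c ⟩
  suc c * (2 * a + suc c)                   ∎
  where
  open ≡-Reasoning
  regroup : ∀ a s c → 2 * (a + s) + suc c ≡ 2 * a + (2 * s + c) + 1
  regroup = solve-∀
  expand : ∀ a c → 2 * a + c * (2 * suc a + c) + 1 ≡ suc c * (2 * a + suc c)
  expand = solve-∀

module Potential (n : ℕ) where
  open Sweeps n

  -- The expected number of sweeps until a star at position p is replaced (see drift).
  h : ℕ → ℕ
  h zero    = 0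
  h (suc k) = suc (rangeSum k (n ∸ k))

  H′ : ℕ
  H′ = rangeSum 0 n

  H : ℕ
  H = suc H′

  h≤H*alive : ∀ q → h q ≤ H * alive q
  h≤H*alive zero    = z≤n
  h≤H*alive (suc k) = begin
    suc (rangeSum k (n ∸ k))        ≡⟨ cong (λ a → suc (rangeSum a (n ∸ k))) (+-identityʳ k) ⟨
    suc (rangeSum (k + 0) (n ∸ k))  ≤⟨ s≤s (rangeSum-suffix≤ k 0 n) ⟩
    H                               ≡⟨ *-identityʳ H ⟨
    H * 1                           ∎
    where open ≤-Reasoning

  h-step : ∀ {k} → suc (suc k) ≤ n → h (suc k) ≡ k + h (suc (suc k))
  h-step {k} 2+k≤n = begin
    suc (rangeSum k (n ∸ k))               ≡⟨ cong (suc ∘ rangeSum k) (+-∸-assoc 1 (<⇒≤ 2+k≤n)) ⟩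
    suc (k + rangeSum (suc k) (n ∸ suc k)) ≡⟨ +-suc k _ ⟨
    k + h (suc (suc k))                    ∎
    where open ≡-Reasoning

  h-top : ∀ {k} → suc k ≡ n → h (suc k) ≡ suc k
  h-top {k} 1+k≡n = trans (cong (suc ∘ rangeSum k) (trans (cong (_∸ k) (sym 1+k≡n)) (m+n∸n≡m 1 k)))
                          (cong suc (+-identityʳ k))

  exitSum-drift : ∀ k d → suc k + suc d ≡ n → exitSum h (suc k) (suc d) + 2 ^ suc d * suc k ≡ 2 ^ suc d * h (suc k)
  exitSum-drift k zero    1+k+1≡n = begin
    1 * h (suc k) + 0 + 2 * 1 * suc k  ≡⟨ cong (λ x → 1 * x + 0 + 2 * 1 * suc k) h[1+k]≡2[1+k] ⟩
    1 * (2 * suc k) + 0 + 2 * 1 * suc k ≡⟨ double (suc k) ⟩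
    2 * 1 * (2 * suc k)                ≡⟨ cong (2 * 1 *_) h[1+k]≡2[1+k] ⟨
    2 * 1 * h (suc k)                  ∎
    where
    open ≡-Reasoning
    2+k≡n : suc (suc k) ≡ n
    2+k≡n = trans (cong suc (+-comm 1 k)) 1+k+1≡n
    h[1+k]≡2[1+k] : h (suc k) ≡ 2 * suc k
    h[1+k]≡2[1+k] = trans (h-step (≤-reflexive 2+k≡n)) (trans (cong (k +_) (h-top 2+k≡n)) (k+[2+k]≡2[1+k] k))
      where
      k+[2+k]≡2[1+k] : ∀ k → k + suc (suc k) ≡ 2 * suc k
      k+[2+k]≡2[1+k] = solve-∀
    double : ∀ x → 1 * (2 * x) + 0 + 2 * 1 * x ≡ 2 * 1 * (2 * x)
    double = solve-∀
  exitSum-drift k (suc d) 1+k+2+d≡n = begin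
    X * h (suc k) + E + 2 * X * suc k        ≡⟨ cong (λ x → X * x + E + 2 * X * suc k) (h-step (<⇒≤ 2+k<n)) ⟩
    X * (k + h₂) + E + 2 * X * suc k         ≡⟨ regroup X k h₂ E ⟩
    E + X * suc (suc k) + (X * k + X * (k + h₂)) ≡⟨ cong (_+ (X * k + X * (k + h₂))) (exitSum-drift (suc k) d 2+k+1+d≡n) ⟩
    X * h₂ + (X * k + X * (k + h₂))          ≡⟨ collect X k h₂ ⟩
    2 * X * (k + h₂)                         ≡⟨ cong (2 * X *_) (h-step (<⇒≤ 2+k<n)) ⟨
    2 * X * h (suc k)                        ∎
    where
    open ≡-Reasoning
    X  = 2 ^ suc d
    h₂ = h (suc (suc k))
    E  = exitSum h (suc (suc k)) (suc d)
    2+k+1+d≡n : suc (suc k) + suc d ≡ n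
    2+k+1+d≡n = trans (sym (+-suc (suc k) (suc d))) 1+k+2+d≡n
    2+k<n : suc (suc k) < n
    2+k<n = ≤-trans (s≤s (s≤s (s≤s (m≤m+n k d)))) (≤-reflexive (trans (cong (suc ∘ suc) (sym (+-suc k d))) 2+k+1+d≡n))
    regroup : ∀ X k h₂ E → X * (k + h₂) + E + 2 * X * suc k ≡ E + X * suc (suc k) + (X * k + X * (k + h₂))
    regroup = solve-∀
    collect : ∀ X k h₂ → X * h₂ + (X * k + X * (k + h₂)) ≡ 2 * X * (k + h₂)
    collect = solve-∀

  drift-closed : ∀ {q} → q < n → closedSweepSum h q + D * alive q ≡ D * h q
  drift-closed {zero}        _   = trans (cong (D * 0 +_) (*-zeroʳ D)) (+-identityʳ (D * 0))
  drift-closed {suc zero}    1<n =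
    subst (λ m → exitSum h 1 m + 2 ^ m * 1 ≡ 2 ^ m * h 1) (sym n∸1≡1+d) (exitSum-drift 0 d 2+d≡n)
    where
    d = n ∸ 2
    n∸1≡1+d : n ∸ 1 ≡ suc d
    n∸1≡1+d = +-∸-assoc 1 1<n
    2+d≡n : 2 + d ≡ n
    2+d≡n = m+[n∸m]≡n 1<n
  drift-closed {suc (suc k)} 2+k<n with n ∸ suc (suc k) in c≡
  ... | zero  = contradiction c≡ (m>n⇒m∸n≢0 2+k<n)
  ... | suc d = begin
    Y * (X * h (suc k) + E) + D * 1            ≡⟨ cong₂ (λ x y → Y * (X * x + E) + y * 1) (h-step (<⇒≤ 2+k<n)) D≡Y*2X ⟩
    Y * (X * (k + h₂) + E) + Y * (2 * X) * 1   ≡⟨ regroup Y X k h₂ E ⟩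
    Y * (E + X * suc (suc k)) + Y * X * h₂     ≡⟨ cong (λ x → Y * x + Y * X * h₂) (exitSum-drift (suc k) d 2+k+1+d≡n) ⟩
    Y * (X * h₂) + Y * X * h₂                  ≡⟨ collect Y X h₂ ⟩
    Y * (2 * X) * h₂                           ≡⟨ cong (_* h₂) D≡Y*2X ⟨
    D * h₂                                     ∎
    where
    open ≡-Reasoning
    Y  = 2 ^ k
    X  = 2 ^ suc d
    h₂ = h (suc (suc k))
    E  = exitSum h (suc (suc k)) (suc d)
    2+k+1+d≡n : suc (suc k) + suc d ≡ n
    2+k+1+d≡n = trans (cong (suc (suc k) +_) (sym c≡)) (m+[n∸m]≡n (<⇒≤ 2+k<n))
    D≡Y*2X : D ≡ Y * (2 * X)
    D≡Y*2X = trans (cong (2 ^_) n∸1≡k+2+d) (^-distribˡ-+-* 2 k (suc (suc d)))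
      where
      n∸1≡k+2+d : n ∸ 1 ≡ k + suc (suc d)
      n∸1≡k+2+d = trans (cong (_∸ 1) (sym 2+k+1+d≡n)) (sym (+-suc k (suc d)))
    regroup : ∀ Y X k h₂ E → Y * (X * (k + h₂) + E) + Y * (2 * X) * 1 ≡ Y * (E + X * suc (suc k)) + Y * X * h₂
    regroup = solve-∀
    collect : ∀ Y X h₂ → Y * (X * h₂) + Y * X * h₂ ≡ Y * (2 * X) * h₂
    collect = solve-∀

  drift : ∀ {q} → q < n → sweepSum h q + D * alive q ≡ D * h q
  drift {q} q<n = trans (cong (_+ D * alive q) (sweepSum-closed h q<n)) (drift-closed q<n)

  contraction : ∀ {q} → q < n → H * sweepSum h q ≤ D * H′ * h q
  contraction {q} q<n = +-cancelʳ-≤ (D * h q) _ _ (begin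
    H * P + D * h q              ≤⟨ +-monoʳ-≤ (H * P) (*-monoʳ-≤ D (h≤H*alive q)) ⟩
    H * P + D * (H * alive q)    ≡⟨ factor H P D (alive q) ⟩
    H * (P + D * alive q)        ≡⟨ cong (H *_) (drift q<n) ⟩
    H * (D * h q)                ≡⟨ expand H′ D (h q) ⟩
    D * H′ * h q + D * h q       ∎)
    where
    open ≤-Reasoning
    P = sweepSum h q
    factor : ∀ H P D a → H * P + D * (H * a) ≡ H * (P + D * a)
    factor = solve-∀
    expand : ∀ H′ D x → suc H′ * (D * x) ≡ D * H′ * x + D * x
    expand = solve-∀

  alive-decay : ∀ {q} → q < n → sweepSum alive q ≤ D * alive q
  alive-decay {zero}  0<n = ≤-reflexive (sweepSumFrom-frozen (n ∸ 1) alive (s≤s z≤n) 0<n)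
  alive-decay {suc k} _   = begin
    sweepSum alive (suc k)        ≤⟨ ∑-mono (λ cs → alive≤1 (sweepPos n 1 cs (suc k))) (coinVecs (n ∸ 1)) ⟩
    ∑[ _ ∈ coinVecs (n ∸ 1) ] 1   ≡⟨ ∑-const 1 (coinVecs (n ∸ 1)) ⟩
    length (coinVecs (n ∸ 1)) * 1 ≡⟨ cong (_* 1) (length-coinVecs (n ∸ 1)) ⟩
    D * 1                         ∎
    where
    open ≤-Reasoning
    alive≤1 : ∀ q → alive q ≤ 1
    alive≤1 zero    = z≤n
    alive≤1 (suc _) = ≤-refl

  2*h[1+k]+k*k+n≡n*n+k+2 : ∀ {k} → k < n → 2 * h (suc k) + k * k + n ≡ n * n + k + 2
  2*h[1+k]+k*k+n≡n*n+k+2 {k} k<n = begin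
    2 * suc (rangeSum k c) + k * k + n    ≡⟨ cong (2 * suc (rangeSum k c) + k * k +_) k+c≡n ⟨
    2 * suc (rangeSum k c) + k * k + (k + c) ≡⟨ regroup k (rangeSum k c) c ⟩
    2 + (2 * rangeSum k c + c) + k * k + k ≡⟨ cong (λ x → 2 + x + k * k + k) (2*rangeSum+c≡c*[2a+c] k c) ⟩
    2 + c * (2 * k + c) + k * k + k       ≡⟨ complete-square k c ⟩
    (k + c) * (k + c) + k + 2             ≡⟨ cong (λ m → m * m + k + 2) k+c≡n ⟩
    n * n + k + 2                         ∎
    where
    open ≡-Reasoning
    c = n ∸ k
    k+c≡n : k + c ≡ n
    k+c≡n = m+[n∸m]≡n (<⇒≤ k<n)
    regroup : ∀ k r c → 2 * suc r + k * k + (k + c) ≡ 2 + (2 * r + c) + k * k + k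
    regroup = solve-∀
    complete-square : ∀ k c → 2 + c * (2 * k + c) + k * k + k ≡ (k + c) * (k + c) + k + 2
    complete-square = solve-∀

  Σh : ℕ
  Σh = ∑ (downFrom n) h

  ∑h-closed : ∀ {k} → k < n →
    12 * ∑ (downFrom (suc k)) h + 6 * k * n + k * suc k * (2 * k + 1) ≡ 6 * k * (n * n) + 9 * k * suc k
  ∑h-closed {zero}  _     = refl
  ∑h-closed {suc k} 1+k<n = begin
    12 * (h (suc k) + S) + 6 * suc k * n + suc k * suc (suc k) * (2 * suc k + 1)
      ≡⟨ regroup (h (suc k)) S k n ⟩
    (12 * S + 6 * k * n + k * suc k * (2 * k + 1)) + 6 * (2 * h (suc k) + k * k + n) + 12 * k + 6
      ≡⟨ cong₂ (λ x y → x + 6 * y + 12 * k + 6) (∑h-closed (<⇒≤ 1+k<n)) (2*h[1+k]+k*k+n≡n*n+k+2 (<⇒≤ 1+k<n)) ⟩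
    6 * k * (n * n) + 9 * k * suc k + 6 * (n * n + k + 2) + 12 * k + 6
      ≡⟨ collect k (n * n) ⟩
    6 * suc k * (n * n) + 9 * suc k * suc (suc k) ∎
    where
    open ≡-Reasoning
    S = ∑ (downFrom (suc k)) h
    regroup : ∀ x S k n → 12 * (x + S) + 6 * suc k * n + suc k * suc (suc k) * (2 * suc k + 1)
                          ≡ (12 * S + 6 * k * n + k * suc k * (2 * k + 1)) + 6 * (2 * x + k * k + n) + 12 * k + 6
    regroup = solve-∀
    collect : ∀ k N → 6 * k * N + 9 * k * suc k + 6 * (N + k + 2) + 12 * k + 6 ≡ 6 * suc k * N + 9 * suc k * suc (suc k)
    collect = solve-∀

  2H+n≡n*n+2 : 1 ≤ n → 2 * H + n ≡ n * n + 2
  2H+n≡n*n+2 1≤n = begin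
    2 * H + n          ≡⟨ cong (_+ n) (+-identityʳ (2 * H)) ⟨
    2 * H + 0 * 0 + n  ≡⟨ 2*h[1+k]+k*k+n≡n*n+k+2 1≤n ⟩
    n * n + 0 + 2      ≡⟨ cong (_+ 2) (+-identityʳ (n * n)) ⟩
    n * n + 2          ∎
    where open ≡-Reasoning

  3Σh+n≡n*n*n : 1 ≤ n → 3 * Σh + n ≡ n * n * n
  3Σh+n≡n*n*n 1≤n = subst (λ m → 3 * ∑ (downFrom m) h + m ≡ m * m * m) (sym n≡1+k)
    (*-cancelˡ-≡ _ _ 4 (+-cancelʳ-≡ E _ _ (begin
      4 * (3 * S + suc k) + E                      ≡⟨ regroup S k ⟩
      (12 * S + 6 * k * suc k + E′) + 4 * suc k    ≡⟨ cong (_+ 4 * suc k) partial ⟩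
      6 * k * (suc k * suc k) + 9 * k * suc k + 4 * suc k ≡⟨ cube k ⟩
      4 * (suc k * suc k * suc k) + E              ∎)))
    where
    open ≡-Reasoning
    k = n ∸ 1
    n≡1+k : n ≡ suc k
    n≡1+k = sym (m+[n∸m]≡n 1≤n)
    S  = ∑ (downFrom (suc k)) h
    E′ = k * suc k * (2 * k + 1)
    E  = 6 * k * suc k + E′
    partial : 12 * S + 6 * k * suc k + E′ ≡ 6 * k * (suc k * suc k) + 9 * k * suc k
    partial = subst (λ m → 12 * S + 6 * k * m + E′ ≡ 6 * k * (m * m) + 9 * k * suc k) n≡1+k
                    (∑h-closed (≤-reflexive (sym n≡1+k)))
    regroup : ∀ S k → 4 * (3 * S + suc k) + (6 * k * suc k + k * suc k * (2 * k + 1))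
                      ≡ (12 * S + 6 * k * suc k + k * suc k * (2 * k + 1)) + 4 * suc k
    regroup = solve-∀
    cube : ∀ k → 6 * k * (suc k * suc k) + 9 * k * suc k + 4 * suc k
                 ≡ 4 * (suc k * suc k * suc k) + (6 * k * suc k + k * suc k * (2 * k + 1))
    cube = solve-∀

  3Σh≤2[n+1]H : 1 ≤ n → 3 * Σh ≤ 2 * (n + 1) * H
  3Σh≤2[n+1]H 1≤n = +-cancelʳ-≤ (n * (n + 1)) _ _ (begin
    3 * Σh + n * (n + 1)                          ≤⟨ m≤m+n _ (2 * n + 2) ⟩
    3 * Σh + n * (n + 1) + (2 * n + 2)            ≡⟨ regroup (3 * Σh) n ⟩
    (3 * Σh + n) + (n * n + 2 * n + 2)            ≡⟨ cong (_+ (n * n + 2 * n + 2)) (3Σh+n≡n*n*n 1≤n) ⟩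
    n * n * n + (n * n + 2 * n + 2)               ≡⟨ factor n ⟩
    (n + 1) * (n * n + 2)                         ≡⟨ cong ((n + 1) *_) (2H+n≡n*n+2 1≤n) ⟨
    (n + 1) * (2 * H + n)                         ≡⟨ expand n H ⟩
    2 * (n + 1) * H + n * (n + 1)                 ∎)
    where
    open ≤-Reasoning
    regroup : ∀ x n → x + n * (n + 1) + (2 * n + 2) ≡ (x + n) + (n * n + 2 * n + 2)
    regroup = solve-∀
    factor : ∀ n → n * n * n + (n * n + 2 * n + 2) ≡ (n + 1) * (n * n + 2)
    factor = solve-∀
    expand : ∀ n H → (n + 1) * (2 * H + n) ≡ 2 * (n + 1) * H + n * (n + 1)
    expand = solve-∀

  n*n∸n+3≡2H+1 : 1 ≤ n → n * n ∸ n + 3 ≡ 2 * H + 1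
  n*n∸n+3≡2H+1 1≤n = begin
    n * n ∸ n + 3          ≡⟨ cong (λ m → m ∸ n + 3) n*n≡2H′+n ⟩
    2 * H′ + n ∸ n + 3     ≡⟨ cong (_+ 3) (m+n∸n≡m (2 * H′) n) ⟩
    2 * H′ + 3             ≡⟨ shift H′ ⟩
    2 * H + 1              ∎
    where
    open ≡-Reasoning
    n*n≡2H′+n : n * n ≡ 2 * H′ + n
    n*n≡2H′+n = +-cancelʳ-≡ 2 _ _ (trans (sym (2H+n≡n*n+2 1≤n)) (regroup H′ n))
      where
      regroup : ∀ H′ n → 2 * suc H′ + n ≡ 2 * H′ + n + 2
      regroup = solve-∀
    shift : ∀ H′ → 2 * H′ + 3 ≡ 2 * suc H′ + 1
    shift = solve-∀

^-distribʳ-* : ∀ x y o → (x * y) ^ o ≡ x ^ o * y ^ o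
^-distribʳ-* x y zero    = refl
^-distribʳ-* x y (suc o) = trans (cong (x * y *_) (^-distribʳ-* x y o)) (interchange x y (x ^ o) (y ^ o))
  where
  interchange : ∀ x y a b → x * y * (a * b) ≡ x * a * (y * b)
  interchange = solve-∀

n≤2^⌈log₂n⌉ : ∀ n → n ≤ 2 ^ ⌈log₂ n ⌉
n≤2^⌈log₂n⌉ n = go n (<-wellFounded n)
  where
  go : ∀ n (acc : Acc _<_ n) → n ≤ 2 ^ ⌈log2⌉ n acc
  go zero          _          = z≤n
  go (suc zero)    _          = ≤-refl
  go (suc (suc n)) (acc rec) = begin
    suc (suc n)                   ≡⟨ cong (suc ∘ suc) (⌊n/2⌋+⌈n/2⌉≡n n) ⟨
    suc (suc (⌊ n /2⌋ + ⌈ n /2⌉)) ≤⟨ s≤s (s≤s (+-monoˡ-≤ ⌈ n /2⌉ (⌊n/2⌋≤⌈n/2⌉ n))) ⟩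
    suc (suc (⌈ n /2⌉ + ⌈ n /2⌉)) ≡⟨ double-suc ⌈ n /2⌉ ⟩
    2 * suc ⌈ n /2⌉               ≤⟨ *-monoʳ-≤ 2 (go (suc ⌈ n /2⌉) _) ⟩
    2 * 2 ^ ⌈log2⌉ (suc ⌈ n /2⌉) _  ∎
    where
    open ≤-Reasoning
    double-suc : ∀ c → suc (suc (c + c)) ≡ 2 * suc c
    double-suc = solve-∀

pascal₂ : ∀ k → k C 2 + k ≡ suc k C 2
pascal₂ k = trans (+-comm (k C 2) k) (trans (cong (_+ k C 2) (sym (nC1≡n k))) (nCk+nC[k+1]≡[n+1]C[k+1] k 1))

pascal₃ : ∀ k → k C 3 + k C 2 ≡ suc k C 3
pascal₃ k = trans (+-comm (k C 3) (k C 2)) (nCk+nC[k+1]≡[n+1]C[k+1] k 2)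

2*[kC2]+k≡k*k : ∀ k → 2 * (k C 2) + k ≡ k * k
2*[kC2]+k≡k*k zero    = refl
2*[kC2]+k≡k*k (suc k) = begin
  2 * (suc k C 2) + suc k          ≡⟨ cong (λ c → 2 * c + suc k) (pascal₂ k) ⟨
  2 * (k C 2 + k) + suc k          ≡⟨ regroup (k C 2) k ⟩
  (2 * (k C 2) + k) + 2 * k + 1    ≡⟨ cong (λ x → x + 2 * k + 1) (2*[kC2]+k≡k*k k) ⟩
  k * k + 2 * k + 1                ≡⟨ square k ⟩
  suc k * suc k                    ∎
  where
  open ≡-Reasoning
  regroup : ∀ c k → 2 * (c + k) + suc k ≡ (2 * c + k) + 2 * k + 1
  regroup = solve-∀
  square : ∀ k → k * k + 2 * k + 1 ≡ suc k * suc k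
  square = solve-∀

6*[kC3]+3*k*k≡k*k*k+2*k : ∀ k → 6 * (k C 3) + 3 * (k * k) ≡ k * k * k + 2 * k
6*[kC3]+3*k*k≡k*k*k+2*k zero    = refl
6*[kC3]+3*k*k≡k*k*k+2*k (suc k) = +-cancelʳ-≡ (3 * k) _ _ (begin
  6 * (suc k C 3) + 3 * (suc k * suc k) + 3 * k
    ≡⟨ cong (λ c → 6 * c + 3 * (suc k * suc k) + 3 * k) (pascal₃ k) ⟨
  6 * (k C 3 + k C 2) + 3 * (suc k * suc k) + 3 * k
    ≡⟨ regroup (k C 3) (k C 2) k ⟩
  (6 * (k C 3) + 3 * (k * k)) + 3 * (2 * (k C 2) + k) + 6 * k + 3
    ≡⟨ cong₂ (λ x y → x + 3 * y + 6 * k + 3) (6*[kC3]+3*k*k≡k*k*k+2*k k) (2*[kC2]+k≡k*k k) ⟩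
  k * k * k + 2 * k + 3 * (k * k) + 6 * k + 3
    ≡⟨ cube k ⟩
  suc k * suc k * suc k + 2 * suc k + 3 * k ∎)
  where
  open ≡-Reasoning
  regroup : ∀ c₃ c₂ k → 6 * (c₃ + c₂) + 3 * (suc k * suc k) + 3 * k ≡ (6 * c₃ + 3 * (k * k)) + 3 * (2 * c₂ + k) + 6 * k + 3
  regroup = solve-∀
  cube : ∀ k → k * k * k + 2 * k + 3 * (k * k) + 6 * k + 3 ≡ suc k * suc k * suc k + 2 * suc k + 3 * k
  cube = solve-∀

binomial₄ : ℕ → ℕ → ℕ
binomial₄ m k = m * m * m + k * (m * m) + (k C 2) * m + k C 3

binomial₄-≤ : ∀ m k → m ^ k * binomial₄ m k ≤ m * m * m * suc m ^ k
binomial₄-≤ m zero    = ≤-reflexive (solve m)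
  where
  solve : ∀ m → 1 * (m * m * m + 0 * (m * m) + 0 * m + 0) ≡ m * m * m * 1
  solve = solve-∀
binomial₄-≤ m (suc k) = begin
  m ^ suc k * binomial₄ m (suc k)
    ≡⟨ cong₂ (λ c₂ c₃ → m ^ suc k * (m * m * m + suc k * (m * m) + c₂ * m + c₃)) (pascal₂ k) (pascal₃ k) ⟨
  m ^ suc k * (m * m * m + suc k * (m * m) + (k C 2 + k) * m + (k C 3 + k C 2))
    ≤⟨ m≤m+n _ (m ^ k * (k C 3)) ⟩
  m ^ suc k * (m * m * m + suc k * (m * m) + (k C 2 + k) * m + (k C 3 + k C 2)) + m ^ k * (k C 3)
    ≡⟨ expand m k (m ^ k) (k C 2) (k C 3) ⟩
  suc m * (m ^ k * binomial₄ m k)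
    ≤⟨ *-monoʳ-≤ (suc m) (binomial₄-≤ m k) ⟩
  suc m * (m * m * m * suc m ^ k)
    ≡⟨ rearrange m (suc m ^ k) ⟩
  m * m * m * suc m ^ suc k ∎
  where
  open ≤-Reasoning
  expand : ∀ m k p c₂ c₃ → m * p * (m * m * m + suc k * (m * m) + (c₂ + k) * m + (c₃ + c₂)) + p * c₃
                           ≡ suc m * (p * (m * m * m + k * (m * m) + c₂ * m + c₃))
  expand = solve-∀
  rearrange : ∀ m q → suc m * (m * m * m * q) ≡ m * m * m * (suc m * q)
  rearrange = solve-∀

6*binomial₄+m≡16m³+9m² : ∀ m → 6 * binomial₄ m (suc m) + m ≡ 16 * (m * m * m) + 9 * (m * m)
6*binomial₄+m≡16m³+9m² m = +-cancelʳ-≡ (3 * m * k + 3 * (k * k)) _ _ (begin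
  6 * binomial₄ m k + m + (3 * m * k + 3 * (k * k))
    ≡⟨ regroup m k (k C 2) (k C 3) ⟩
  6 * (m * m * m) + 6 * k * (m * m) + 3 * m * (2 * (k C 2) + k) + (6 * (k C 3) + 3 * (k * k)) + m
    ≡⟨ cong₂ (λ x y → 6 * (m * m * m) + 6 * k * (m * m) + 3 * m * x + y + m)
             (2*[kC2]+k≡k*k k) (6*[kC3]+3*k*k≡k*k*k+2*k k) ⟩
  6 * (m * m * m) + 6 * k * (m * m) + 3 * m * (k * k) + (k * k * k + 2 * k) + m
    ≡⟨ evaluate m ⟩
  16 * (m * m * m) + 9 * (m * m) + (3 * m * k + 3 * (k * k)) ∎)
  where
  open ≡-Reasoning
  k = suc m
  regroup : ∀ m k c₂ c₃ → 6 * (m * m * m + k * (m * m) + c₂ * m + c₃) + m + (3 * m * k + 3 * (k * k))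
                          ≡ 6 * (m * m * m) + 6 * k * (m * m) + 3 * m * (2 * c₂ + k) + (6 * c₃ + 3 * (k * k)) + m
  regroup = solve-∀
  evaluate : ∀ m → 6 * (m * m * m) + 6 * suc m * (m * m) + 3 * m * (suc m * suc m) + (suc m * suc m * suc m + 2 * suc m) + m
                   ≡ 16 * (m * m * m) + 9 * (m * m) + (3 * m * suc m + 3 * (suc m * suc m))
  evaluate = solve-∀

8*m*m*m≤3*binomial₄ : ∀ m → 8 * (m * m * m) ≤ 3 * binomial₄ m (suc m)
8*m*m*m≤3*binomial₄ zero        = z≤n
8*m*m*m≤3*binomial₄ m@(suc _) = *-cancelˡ-≤ 2 (+-cancelʳ-≤ m _ _ (begin
  2 * (8 * (m * m * m)) + m            ≤⟨ +-monoʳ-≤ (2 * (8 * (m * m * m))) (≤-trans (m≤m*n m m) (m≤n*m (m * m) 9)) ⟩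
  2 * (8 * (m * m * m)) + 9 * (m * m)  ≡⟨ cong (_+ 9 * (m * m)) (*-assoc 2 8 (m * m * m)) ⟨
  16 * (m * m * m) + 9 * (m * m)       ≡⟨ 6*binomial₄+m≡16m³+9m² m ⟨
  6 * B + m                            ≡⟨ cong (_+ m) (*-assoc 2 3 B) ⟩
  2 * (3 * B) + m                      ∎))
  where
  open ≤-Reasoning
  B = binomial₄ m (suc m)

8*m^[1+m]≤3*[1+m]^[1+m] : ∀ m → 8 * m ^ suc m ≤ 3 * suc m ^ suc m
8*m^[1+m]≤3*[1+m]^[1+m] zero        = z≤n
8*m^[1+m]≤3*[1+m]^[1+m] m@(suc _) = *-cancelˡ-≤ (m * m * m) (begin
  m * m * m * (8 * P)              ≡⟨ rearrange (m * m * m) 8 P ⟩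
  P * (8 * (m * m * m))            ≤⟨ *-monoʳ-≤ P (8*m*m*m≤3*binomial₄ m) ⟩
  P * (3 * B)                      ≡⟨ swap P 3 B ⟩
  3 * (P * B)                      ≤⟨ *-monoʳ-≤ 3 (binomial₄-≤ m (suc m)) ⟩
  3 * (m * m * m * suc m ^ suc m)  ≡⟨ swap 3 (m * m * m) (suc m ^ suc m) ⟩
  m * m * m * (3 * suc m ^ suc m)  ∎)
  where
  open ≤-Reasoning
  P = m ^ suc m
  B = binomial₄ m (suc m)
  rearrange : ∀ x y z → x * (y * z) ≡ z * (y * x)
  rearrange = solve-∀
  swap : ∀ x y z → x * (y * z) ≡ y * (x * z)
  swap = solve-∀

4*3^M*[2^[1+M]+1]≤3*8^M : ∀ j → 4 * 3 ^ (4 + j) * (2 ^ (5 + j) + 1) ≤ 3 * 8 ^ (4 + j)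
4*3^M*[2^[1+M]+1]≤3*8^M zero    = ≤ᵇ⇒≤ 10692 12288 _
4*3^M*[2^[1+M]+1]≤3*8^M (suc j) = begin
  4 * (3 * p₃) * (2 * p₂ + 1)        ≤⟨ m≤m+n _ (12 * p₃) ⟩
  4 * (3 * p₃) * (2 * p₂ + 1) + 12 * p₃ ≡⟨ regroup p₃ p₂ ⟩
  6 * (4 * p₃ * (p₂ + 1))            ≤⟨ *-monoʳ-≤ 6 (4*3^M*[2^[1+M]+1]≤3*8^M j) ⟩
  6 * (3 * 8 ^ (4 + j))            ≤⟨ *-monoˡ-≤ (3 * 8 ^ (4 + j)) (≤ᵇ⇒≤ 6 8 _) ⟩
  8 * (3 * 8 ^ (4 + j))            ≡⟨ swap 8 3 (8 ^ (4 + j)) ⟩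
  3 * 8 ^ (5 + j)                  ∎
  where
  open ≤-Reasoning
  p₃ = 3 ^ (4 + j)
  p₂ = 2 ^ (5 + j)
  regroup : ∀ a b → 4 * (3 * a) * (2 * b + 1) + 12 * a ≡ 6 * (4 * a * (b + 1))
  regroup = solve-∀
  swap : ∀ x y z → x * (y * z) ≡ y * (x * z)
  swap = solve-∀

-- Survival bounds

at : List ℕ → ℕ → ℕ
at []       _       = 0
at (x ∷ _)  zero    = x
at (_ ∷ xs) (suc p) = at xs p

at-applyUpTo : ∀ f {m p} → p < m → at (applyUpTo f m) p ≡ f p
at-applyUpTo f {suc m} {zero}  _         = refl
at-applyUpTo f {suc m} {suc p} (s≤s p<m) = at-applyUpTo (f ∘ suc) p<m

module Survival (n : ℕ) where
  open Sweeps n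
  open Potential n

  survival-decay : ∀ t {p} → p < n → runSum (suc t) alive p ≤ D * runSum t alive p
  survival-decay t {p} p<n = begin
    runSum (suc t) alive p          ≡⟨ runSum-sweepSum t alive p ⟩
    runSum t (sweepSum alive) p     ≤⟨ runSum-mono-< t alive-decay p<n ⟩
    runSum t (λ q → D * alive q) p  ≡⟨ runSum-distribˡ-* t D alive p ⟩
    D * runSum t alive p            ∎
    where open ≤-Reasoning

  drift⁺ : ∀ t {p} → p < n → runSum t (sweepSum h) p + D * runSum t alive p ≡ D * runSum t h p
  drift⁺ t {p} p<n = begin
    runSum t (sweepSum h) p + D * runSum t alive p            ≡⟨ cong (runSum t (sweepSum h) p +_) (runSum-distribˡ-* t D alive p) ⟨
    runSum t (sweepSum h) p + runSum t (λ q → D * alive q) p  ≡⟨ runSum-distrib-+ t (sweepSum h) (λ q → D * alive q) p ⟨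
    runSum t (λ q → sweepSum h q + D * alive q) p             ≡⟨ runSum-cong-< t drift p<n ⟩
    runSum t (λ q → D * h q) p                                ≡⟨ runSum-distribˡ-* t D h p ⟩
    D * runSum t h p                                          ∎
    where open ≡-Reasoning

  markov : ∀ s {p} → p < n → s * runSum s alive p + runSum s h p ≤ D ^ s * h p
  markov zero    {p} _   = ≤-reflexive (trans (runSum-zero h p) (sym (*-identityˡ (h p))))
  markov (suc s) {p} p<n = begin
    suc s * runSum (suc s) alive p + runSum (suc s) h p  ≡⟨ cong (suc s * runSum (suc s) alive p +_) (runSum-sweepSum s h p) ⟩
    suc s * runSum (suc s) alive p + Ph                  ≤⟨ +-monoˡ-≤ Ph (*-monoʳ-≤ (suc s) (survival-decay s p<n)) ⟩
    suc s * (D * A) + Ph                                 ≡⟨ regroup s D A Ph ⟩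
    D * (s * A) + (Ph + D * A)                           ≡⟨ cong (D * (s * A) +_) (drift⁺ s p<n) ⟩
    D * (s * A) + D * runSum s h p                       ≡⟨ *-distribˡ-+ D (s * A) (runSum s h p) ⟨
    D * (s * A + runSum s h p)                           ≤⟨ *-monoʳ-≤ D (markov s p<n) ⟩
    D * (D ^ s * h p)                                    ≡⟨ *-assoc D (D ^ s) (h p) ⟨
    D ^ suc s * h p                                      ∎
    where
    open ≤-Reasoning
    A  = runSum s alive p
    Ph = runSum s (sweepSum h) p
    regroup : ∀ s D a x → suc s * (D * a) + x ≡ D * (s * a) + (x + D * a)
    regroup = solve-∀

  contraction⁺ : ∀ a {p} → p < n → H ^ a * runSum a h p ≤ (D * H′) ^ a * h p
  contraction⁺ zero    {p} _   = ≤-reflexive (cong (1 *_) (runSum-zero h p))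
  contraction⁺ (suc a) {p} p<n = begin
    H ^ suc a * runSum (suc a) h p               ≡⟨ cong (H ^ suc a *_) (runSum-sweepSum a h p) ⟩
    H * H ^ a * runSum a (sweepSum h) p          ≡⟨ rearrange H (H ^ a) (runSum a (sweepSum h) p) ⟩
    H ^ a * (H * runSum a (sweepSum h) p)        ≡⟨ cong (H ^ a *_) (runSum-distribˡ-* a H (sweepSum h) p) ⟨
    H ^ a * runSum a (λ q → H * sweepSum h q) p  ≤⟨ *-monoʳ-≤ (H ^ a) (runSum-mono-< a contraction p<n) ⟩
    H ^ a * runSum a (λ q → D * H′ * h q) p      ≡⟨ cong (H ^ a *_) (runSum-distribˡ-* a (D * H′) h p) ⟩
    H ^ a * (D * H′ * runSum a h p)              ≡⟨ swap (H ^ a) (D * H′) (runSum a h p) ⟩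
    D * H′ * (H ^ a * runSum a h p)              ≤⟨ *-monoʳ-≤ (D * H′) (contraction⁺ a p<n) ⟩
    D * H′ * ((D * H′) ^ a * h p)                ≡⟨ *-assoc (D * H′) _ (h p) ⟨
    (D * H′) ^ suc a * h p                       ∎
    where
    open ≤-Reasoning
    rearrange : ∀ x y z → x * y * z ≡ y * (x * z)
    rearrange = solve-∀
    swap : ∀ x y z → x * (y * z) ≡ y * (x * z)
    swap = solve-∀

  survival-bound : ∀ a s {p} → p < n → H ^ a * (s * runSum (a + s) alive p) ≤ D ^ s * ((D * H′) ^ a * h p)
  survival-bound a s {p} p<n = begin
    H ^ a * (s * runSum (a + s) alive p)             ≡⟨ cong (λ x → H ^ a * (s * x)) (runSum-+ a s alive p) ⟩
    H ^ a * (s * runSum a (runSum s alive) p)        ≡⟨ cong (H ^ a *_) (runSum-distribˡ-* a s (runSum s alive) p) ⟨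
    H ^ a * runSum a (λ q → s * runSum s alive q) p  ≤⟨ *-monoʳ-≤ (H ^ a) (runSum-mono-< a markov′ p<n) ⟩
    H ^ a * runSum a (λ q → D ^ s * h q) p           ≡⟨ cong (H ^ a *_) (runSum-distribˡ-* a (D ^ s) h p) ⟩
    H ^ a * (D ^ s * runSum a h p)                   ≡⟨ swap (H ^ a) (D ^ s) (runSum a h p) ⟩
    D ^ s * (H ^ a * runSum a h p)                   ≤⟨ *-monoʳ-≤ (D ^ s) (contraction⁺ a p<n) ⟩
    D ^ s * ((D * H′) ^ a * h p)                     ∎
    where
    open ≤-Reasoning
    markov′ : ∀ {q} → q < n → s * runSum s alive q ≤ D ^ s * h q
    markov′ {q} q<n = ≤-trans (m≤m+n (s * runSum s alive q) _) (markov s q<n)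
    swap : ∀ x y z → x * (y * z) ≡ y * (x * z)
    swap = solve-∀

  survivors-decay : ∀ t → survivors (suc t) ≤ D * survivors t
  survivors-decay t = ≤-trans (∑-mono-∈ (survival-decay t ∘ ∈-downFrom⁻))
                              (≤-reflexive (∑-distribˡ-* D (runSum t alive) (downFrom n)))

  survivors-bound : ∀ a s → H ^ a * (s * survivors (a + s)) ≤ D ^ s * ((D * H′) ^ a * Σh)
  survivors-bound a s = begin
    H ^ a * (s * survivors (a + s))                         ≡⟨ pull-out (H ^ a) s (λ p → runSum (a + s) alive p) ⟨
    ∑[ p ∈ downFrom n ] (H ^ a * (s * runSum (a + s) alive p))   ≤⟨ ∑-mono-∈ (survival-bound a s ∘ ∈-downFrom⁻) ⟩
    ∑[ p ∈ downFrom n ] (D ^ s * ((D * H′) ^ a * h p))      ≡⟨ pull-out (D ^ s) ((D * H′) ^ a) h ⟩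
    D ^ s * ((D * H′) ^ a * Σh)                             ∎
    where
    open ≤-Reasoning
    pull-out : ∀ x y f → ∑[ p ∈ downFrom n ] (x * (y * f p)) ≡ x * (y * ∑ (downFrom n) f)
    pull-out x y f = trans (∑-distribˡ-* x (λ p → y * f p) (downFrom n)) (cong (x *_) (∑-distribˡ-* y f (downFrom n)))

  survivors-half-split : ∀ a s → 1 ≤ s → 2 * (H′ ^ a * Σh) ≤ s * H ^ a → 2 * survivors (a + s) ≤ D ^ (a + s)
  survivors-half-split a s 1≤s 2H′ᵃΣh≤sHᵃ = *-cancelˡ-≤ (s * H ^ a) {{sHᵃ≢0}} (begin
    s * H ^ a * (2 * X)                  ≡⟨ rearrange s (H ^ a) X ⟩
    2 * (H ^ a * (s * X))                ≤⟨ *-monoʳ-≤ 2 (survivors-bound a s) ⟩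
    2 * (D ^ s * ((D * H′) ^ a * Σh))    ≡⟨ cong (λ y → 2 * (D ^ s * (y * Σh))) (^-distribʳ-* D H′ a) ⟩
    2 * (D ^ s * (D ^ a * H′ ^ a * Σh))  ≡⟨ rearrange′ (D ^ s) (D ^ a) (H′ ^ a) Σh ⟩
    D ^ s * D ^ a * (2 * (H′ ^ a * Σh))  ≤⟨ *-monoʳ-≤ (D ^ s * D ^ a) 2H′ᵃΣh≤sHᵃ ⟩
    D ^ s * D ^ a * (s * H ^ a)          ≡⟨ *-comm (D ^ s * D ^ a) (s * H ^ a) ⟩
    s * H ^ a * (D ^ s * D ^ a)          ≡⟨ cong (s * H ^ a *_) (^-distribˡ-+-* D s a) ⟨
    s * H ^ a * D ^ (s + a)              ≡⟨ cong (λ x → s * H ^ a * D ^ x) (+-comm s a) ⟩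
    s * H ^ a * D ^ (a + s)              ∎)
    where
    open ≤-Reasoning
    X = survivors (a + s)
    sHᵃ≢0 : NonZero (s * H ^ a)
    sHᵃ≢0 = >-nonZero (*-mono-≤ 1≤s (m^n>0 H a))
    rearrange : ∀ s y x → s * y * (2 * x) ≡ 2 * (y * (s * x))
    rearrange = solve-∀
    rearrange′ : ∀ u v w z → 2 * (u * (v * w * z)) ≡ u * v * (2 * (w * z))
    rearrange′ = solve-∀

  tail-estimate : ∀ j {s} → 1 ≤ n → n ≤ 2 ^ (5 + j) → H ≤ s → 2 * (H′ ^ (H * (4 + j)) * Σh) ≤ s * H ^ (H * (4 + j))
  tail-estimate j {s} 1≤n n≤2^[5+j] H≤s = *-cancelˡ-≤ (3 * 8 ^ M) {{3*8^M≢0}} (begin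
    3 * 8 ^ M * (2 * (P′ * Σh))             ≡⟨ regroup (8 ^ M) P′ Σh ⟩
    2 * (8 ^ M * P′) * (3 * Σh)             ≤⟨ *-mono-≤ (*-monoʳ-≤ 2 8^M*P′≤3^M*Q) (3Σh≤2[n+1]H 1≤n) ⟩
    2 * (3 ^ M * Q) * (2 * (n + 1) * H)     ≡⟨ regroup′ (3 ^ M) Q n H ⟩
    4 * 3 ^ M * (n + 1) * (Q * H)           ≤⟨ *-monoˡ-≤ (Q * H) (*-monoʳ-≤ (4 * 3 ^ M) (+-monoˡ-≤ 1 n≤2^[5+j])) ⟩
    4 * 3 ^ M * (2 ^ (5 + j) + 1) * (Q * H) ≤⟨ *-monoˡ-≤ (Q * H) (4*3^M*[2^[1+M]+1]≤3*8^M j) ⟩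
    3 * 8 ^ M * (Q * H)                     ≤⟨ *-monoʳ-≤ (3 * 8 ^ M) (*-monoʳ-≤ Q H≤s) ⟩
    3 * 8 ^ M * (Q * s)                     ≡⟨ cong (3 * 8 ^ M *_) (*-comm Q s) ⟩
    3 * 8 ^ M * (s * Q)                     ∎)
    where
    open ≤-Reasoning
    M  = 4 + j
    P′ = H′ ^ (H * M)
    Q  = H ^ (H * M)
    3*8^M≢0 : NonZero (3 * 8 ^ M)
    3*8^M≢0 = >-nonZero (*-mono-≤ (s≤s (z≤n {2})) (m^n>0 8 M))
    8^M*P′≤3^M*Q : 8 ^ M * P′ ≤ 3 ^ M * Q
    8^M*P′≤3^M*Q = begin
      8 ^ M * H′ ^ (H * M)    ≡⟨ cong (8 ^ M *_) (^-*-assoc H′ H M) ⟨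
      8 ^ M * (H′ ^ H) ^ M    ≡⟨ ^-distribʳ-* 8 (H′ ^ H) M ⟨
      (8 * H′ ^ H) ^ M        ≤⟨ ^-monoˡ-≤ M (8*m^[1+m]≤3*[1+m]^[1+m] H′) ⟩
      (3 * H ^ H) ^ M         ≡⟨ ^-distribʳ-* 3 (H ^ H) M ⟩
      3 ^ M * (H ^ H) ^ M     ≡⟨ cong (3 ^ M *_) (^-*-assoc H H M) ⟩
      3 ^ M * H ^ (H * M)     ∎
    regroup : ∀ e p x → 3 * e * (2 * (p * x)) ≡ 2 * (e * p) * (3 * x)
    regroup = solve-∀
    regroup′ : ∀ t q n H → 2 * (t * q) * (2 * (n + 1) * H) ≡ 4 * t * (n + 1) * (q * H)
    regroup′ = solve-∀

  survivors-half-large : 17 ≤ n → ∀ t → (n * n ∸ n + 3) * ⌈log₂ n ⌉ ≤ 2 * t → 2 * survivors t ≤ D ^ t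
  survivors-half-large 17≤n t K≤2t =
    subst (λ u → 2 * survivors u ≤ D ^ u) a+s≡t
          (survivors-half-split a s (≤-trans (s≤s z≤n) H≤s) (tail-estimate j 1≤n n≤2^[5+j] H≤s))
    where
    L = ⌈log₂ n ⌉
    j = L ∸ 5
    a = H * (4 + j)
    s = t ∸ a
    1≤n : 1 ≤ n
    1≤n = ≤-trans (s≤s z≤n) 17≤n
    5+j≡L : 5 + j ≡ L
    5+j≡L = m+[n∸m]≡n (⌈log₂⌉-mono-≤ 17≤n)
    n≤2^[5+j] : n ≤ 2 ^ (5 + j)
    n≤2^[5+j] = ≤-trans (n≤2^⌈log₂n⌉ n) (≤-reflexive (cong (2 ^_) (sym 5+j≡L)))
    HL≤t : H * L ≤ t
    HL≤t = *-cancelˡ-≤ 2 (begin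
      2 * (H * L)          ≡⟨ *-assoc 2 H L ⟨
      2 * H * L            ≤⟨ *-monoˡ-≤ L (m≤m+n (2 * H) 1) ⟩
      (2 * H + 1) * L      ≡⟨ cong (_* L) (n*n∸n+3≡2H+1 1≤n) ⟨
      (n * n ∸ n + 3) * L  ≤⟨ K≤2t ⟩
      2 * t                ∎)
      where open ≤-Reasoning
    a+H≤t : a + H ≤ t
    a+H≤t = ≤-trans (≤-reflexive (trans (+-comm a H) (trans (sym (*-suc H (4 + j))) (cong (H *_) 5+j≡L)))) HL≤t
    a+s≡t : a + s ≡ t
    a+s≡t = m+[n∸m]≡n (≤-trans (m≤m+n a H) a+H≤t)
    H≤s : H ≤ s
    H≤s = +-cancelˡ-≤ a H s (≤-trans a+H≤t (≤-reflexive (sym a+s≡t)))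

  survivorTable : ℕ → List ℕ
  survivorTable zero    = applyUpTo alive n
  survivorTable (suc t) = applyUpTo (closedSweepSum (at (survivorTable t))) n

  survivorTable-correct : ∀ t {p} → p < n → at (survivorTable t) p ≡ runSum t alive p
  survivorTable-correct zero    {p} p<n = trans (at-applyUpTo alive p<n) (sym (runSum-zero alive p))
  survivorTable-correct (suc t) {p} p<n = begin
    at (survivorTable (suc t)) p             ≡⟨ at-applyUpTo _ p<n ⟩
    closedSweepSum (at (survivorTable t)) p  ≡⟨ sweepSum-closed _ p<n ⟨
    sweepSum (at (survivorTable t)) p        ≡⟨ sweepSum-cong-< (survivorTable-correct t) p<n ⟩
    sweepSum (runSum t alive) p              ≡⟨ runSum-suc t alive p ⟨
    runSum (suc t) alive p                   ∎
    where open ≡-Reasoning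

  survivorCheck : ℕ → Bool
  survivorCheck t = 2 * ∑ (downFrom n) (at (survivorTable t)) ≤ᵇ D ^ t

  survivors-half-from : ∀ {t₀} → T (survivorCheck t₀) → ∀ {t} → t₀ ≤ t → 2 * survivors t ≤ D ^ t
  survivors-half-from {t₀} check {t} t₀≤t = begin
    2 * survivors t                    ≡⟨ cong (λ u → 2 * survivors u) t∸t₀+t₀≡t ⟨
    2 * survivors (t ∸ t₀ + t₀)        ≤⟨ *-monoʳ-≤ 2 (survivors-decay⁺ (t ∸ t₀)) ⟩
    2 * (D ^ (t ∸ t₀) * survivors t₀)  ≡⟨ swap 2 (D ^ (t ∸ t₀)) (survivors t₀) ⟩
    D ^ (t ∸ t₀) * (2 * survivors t₀)  ≤⟨ *-monoʳ-≤ (D ^ (t ∸ t₀)) 2*survivors[t₀]≤D^t₀ ⟩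
    D ^ (t ∸ t₀) * D ^ t₀              ≡⟨ ^-distribˡ-+-* D (t ∸ t₀) t₀ ⟨
    D ^ (t ∸ t₀ + t₀)                  ≡⟨ cong (D ^_) t∸t₀+t₀≡t ⟩
    D ^ t                              ∎
    where
    open ≤-Reasoning
    t∸t₀+t₀≡t = m∸n+n≡m t₀≤t
    swap : ∀ x y z → x * (y * z) ≡ y * (x * z)
    swap = solve-∀
    survivors-decay⁺ : ∀ k → survivors (k + t₀) ≤ D ^ k * survivors t₀
    survivors-decay⁺ zero    = ≤-reflexive (sym (+-identityʳ _))
    survivors-decay⁺ (suc k) = ≤-trans (survivors-decay (k + t₀))
      (≤-trans (*-monoʳ-≤ D (survivors-decay⁺ k)) (≤-reflexive (sym (*-assoc D (D ^ k) _))))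
    2*survivors[t₀]≤D^t₀ : 2 * survivors t₀ ≤ D ^ t₀
    2*survivors[t₀]≤D^t₀ = subst (λ x → 2 * x ≤ D ^ t₀) (∑-cong-∈ (survivorTable-correct t₀ ∘ ∈-downFrom⁻)) (≤ᵇ⇒≤ _ _ check)

threshold : ℕ → ℕ
threshold n = ⌈ (n * n ∸ n + 3) * ⌈log₂ n ⌉ /2⌉

threshold-≤ : ∀ n t → (n * n ∸ n + 3) * ⌈log₂ n ⌉ ≤ 2 * t → threshold n ≤ t
threshold-≤ n t K≤2t = begin
  ⌈ (n * n ∸ n + 3) * ⌈log₂ n ⌉ /2⌉  ≤⟨ ⌈n/2⌉-mono K≤2t ⟩
  ⌈ t + (t + 0) /2⌉                  ≡⟨ cong (λ x → ⌈ t + x /2⌉) (+-identityʳ t) ⟩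
  ⌈ t + t /2⌉                        ≡⟨ n≡⌈n+n/2⌉ t ⟨
  t                                  ∎
  where open ≤-Reasoning

-- For n < 17 the analytic bound is too weak (it fails e.g. for n = 16), so the exact counts are evaluated.
small-cases : ∀ {n} → n < 17 → T (Survival.survivorCheck n (threshold n))
small-cases = toWitness {a? = allUpTo? (λ n → T? (Survival.survivorCheck n (threshold n))) 17} _

survivors-half : ∀ n t → (n * n ∸ n + 3) * ⌈log₂ n ⌉ ≤ 2 * t →
                 2 * Sweeps.survivors n t ≤ Sweeps.D n ^ t
survivors-half n t K≤2t with 17 ≤? n
... | yes 17≤n = Survival.survivors-half-large n 17≤n t K≤2t
... | no  n≱17 = Survival.survivors-half-from n (small-cases (≰⇒> n≱17)) (threshold-≤ n t K≤2t)

lemma7 : (n : ℕ) → 2 ≤ n →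
    (_⪯_ : Rel (Fin n) 0ℓ) → IsPartialOrder _≡_ _⪯_ → (_⪯?_ : Decidable _⪯_) →
    (∀ {a b} → a ⪯ b → toℕ a ≤ toℕ b) →
    (t : ℕ) → (n * n ∸ n + 3) * ⌈log₂ n ⌉ ≤ 2 * t →
    2 * badCount n _⪯_ _⪯?_ t ≤ 2 ^ ((n ∸ 1) * t)
lemma7 n@(suc m) _ _⪯_ _ _⪯?_ _ t K≤2t = begin
  2 * badCount n _⪯_ _⪯?_ t  ≤⟨ *-monoʳ-≤ 2 (badCount≤survivors m _⪯_ _⪯?_ t) ⟩
  2 * Sweeps.survivors n t   ≤⟨ survivors-half n t K≤2t ⟩
  (2 ^ (n ∸ 1)) ^ t          ≡⟨ ^-*-assoc 2 (n ∸ 1) t ⟩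
  2 ^ ((n ∸ 1) * t)          ∎
  where open ≤-Reasoning
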